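{- (1) $\mathrm{LF}_\Delta$ is strongly normalizing: (a) if $\Gamma\vdash_\Sigma K$ then $K$ is strongly normalizing; (b) if $\Gamma\vdash_\Sigma\sigma:K$ then $\sigma$ is strongly normalizing; (c) if $\Gamma\vdash_\Sigma\Delta:\sigma$ then $\Delta$ is strongly normalizing (all with respect to $\to_\Delta$). (2) Every strongly normalizing pure $\lambda$-term $M$ can be annotated so as to be the essence of a (typable) $\Delta$-term, i.e. there are $\Sigma,\Gamma,\Delta,\sigma$ with $\Gamma\vdash_\Sigma\Delta:\sigma$ and $|\Delta|=M$.
   Context: $\mathrm{LF}_\Delta$ pseudo-terms (up to $\alpha$-conversion; $a$ family constants, $c$ object constants, $x,y$ variables): Kinds $K ::= \mathrm{Type} \mid \Pi x{:}\sigma.K$; Families $\sigma,\tau ::= a \mid \Pi x{:}\sigma.\tau \mid \sigma\,\Delta \mid \sigma\to^{r}\tau \mid \sigma\cap\tau \mid \sigma\cup\tau$; Objects $\Delta ::= c \mid x \mid \lambda x{:}\sigma.\Delta \mid \Delta\,\Delta \mid \lambda^{r}x{:}\sigma.\Delta \mid \Delta @^{r}\Delta \mid \langle\Delta,\Delta\rangle \mid [\Delta,\Delta] \mid pr_l\,\Delta \mid pr_r\,\Delta \mid in_l^{\sigma}\,\Delta \mid in_r^{\sigma}\,\Delta$. Essence $|\Delta|$ (pure $\lambda$-term): $|c|=c$, $|x|=x$, $|\lambda x{:}\sigma.\Delta|=|\lambda^r x{:}\sigma.\Delta|=\lambda x.|\Delta|$, $|\Delta_1\Delta_2|=|\Delta_1||\Delta_2|$,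 $|\Delta_1@^r\Delta_2|=|\Delta_2|$, $|\langle\Delta_1,\Delta_2\rangle|=|[\Delta_1,\Delta_2]|=|\Delta_1|$, $|pr_i\Delta|=|in_i^\sigma\Delta|=|\Delta|$. Pairs/co-pairs are only considered when their components have identical essences. Reduction $\to_\Delta$: basic rules $(\lambda x{:}\sigma.\Delta_1)\Delta_2\to\Delta_1[\Delta_2/x]$, $pr_l\langle\Delta_1,\Delta_2\rangle\to\Delta_1$, $pr_r\langle\Delta_1,\Delta_2\rangle\to\Delta_2$, $[\Delta_1,\Delta_2](in_l^\sigma\Delta_3)\to\Delta_1\Delta_3$, $[\Delta_1,\Delta_2](in_r^\sigma\Delta_3)\to\Delta_2\Delta_3$, $(\lambda^r x{:}\sigma.\Delta_1)@^r\Delta_2\to\Delta_1[\Delta_2/x]$, closed under all constructors, except that components of pairs/co-pairs are reduced simultaneously ($\langle\Delta_1,\Delta_2\rangle\to\langle\Delta_1',\Delta_2'\rangle$ and $[\Delta_1,\Delta_2]\to[\Delta_1',\Delta_2']$ when $\Delta_i\to\Delta_i'$ for $i=1,2$ and $|\Delta_1'|\equiv|\Delta_2'|$). $=_\Delta$ is the reflexive, symmetric, transitive closure of $\to_\Delta$. $=_\eta$ denotes $\eta$-equality of pure $\lambda$-terms. Judgements: $\vdash\Sigma$, $\vdash_\Sigma\Gamma$, $\Gamma\vdash_\Sigma K$, $\Gamma\vdash_\Sigma\sigma:K$, $\Gamma\vdash_\Sigma\Delta:\sigma$, with rules: Signatures: $\vdash\emptyset$; $\vdash\Sigma,a{:}K$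 if $\vdash\Sigma$, $\vdash_\Sigma K$, $a\notin\mathrm{dom}\,\Sigma$; $\vdash\Sigma,c{:}\sigma$ if $\vdash\Sigma$, $\vdash_\Sigma\sigma:\mathrm{Type}$, $c\notin\mathrm{dom}\,\Sigma$. Contexts: $\vdash_\Sigma\langle\rangle$ if $\vdash\Sigma$; $\vdash_\Sigma\Gamma,x{:}\sigma$ if $\vdash_\Sigma\Gamma$, $\Gamma\vdash_\Sigma\sigma:\mathrm{Type}$, $x\notin\mathrm{dom}\,\Gamma$. Kinds: $\Gamma\vdash_\Sigma\mathrm{Type}$ if $\vdash_\Sigma\Gamma$; $\Gamma\vdash_\Sigma\Pi x{:}\sigma.K$ if $\Gamma,x{:}\sigma\vdash_\Sigma K$. Families: $\Gamma\vdash_\Sigma a:K$ if $\vdash_\Sigma\Gamma$, $a{:}K\in\Sigma$; $\Gamma\vdash_\Sigma\Pi x{:}\sigma.\tau:\mathrm{Type}$ if $\Gamma,x{:}\sigma\vdash_\Sigma\tau:\mathrm{Type}$; $\Gamma\vdash_\Sigma\sigma\,\Delta:K[\Delta/x]$ if $\Gamma\vdash_\Sigma\sigma:\Pi x{:}\tau.K$, $\Gamma\vdash_\Sigma\Delta:\tau$; $\sigma\to^r\tau$, $\sigma\cap\tau$, $\sigma\cup\tau$ have kind $\mathrm{Type}$ if $\sigma,\tau$ do; $\Gamma\vdash_\Sigma\sigma:K_2$ if $\Gamma\vdash_\Sigma\sigma:K_1$, $\Gamma\vdash_\Sigma K_2$, $K_1=_\Delta K_2$. Objects: constants and variables get their declared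 type (in a valid context); $\lambda x{:}\sigma.\Delta:\Pi x{:}\sigma.\tau$ if $\Gamma,x{:}\sigma\vdash_\Sigma\Delta:\tau$; $\Delta_1\Delta_2:\tau[\Delta_2/x]$ if $\Delta_1:\Pi x{:}\sigma.\tau$, $\Delta_2:\sigma$; $\lambda^r x{:}\sigma.\Delta:\sigma\to^r\tau$ if $\Gamma,x{:}\sigma\vdash_\Sigma\Delta:\tau$ and $|\Delta|=_\eta x$; $\Delta_1@^r\Delta_2:\tau$ if $\Delta_1:\sigma\to^r\tau$, $\Delta_2:\sigma$; $\langle\Delta_1,\Delta_2\rangle:\sigma\cap\tau$ if $\Delta_1:\sigma$, $\Delta_2:\tau$, $|\Delta_1|=_\eta|\Delta_2|$; $pr_l\Delta:\sigma$, $pr_r\Delta:\tau$ if $\Delta:\sigma\cap\tau$; $in_l^\tau\Delta:\sigma\cup\tau$ if $\Delta:\sigma$ and $\sigma\cup\tau:\mathrm{Type}$; $in_r^\sigma\Delta:\sigma\cup\tau$ if $\Delta:\tau$ and $\sigma\cup\tau:\mathrm{Type}$; $[\Delta_1,\Delta_2]:\Pi x{:}\sigma\cup\tau.\rho$ if $\Delta_1:\Pi y{:}\sigma.\rho[in_l^\tau y/x]$, $\Delta_2:\Pi y{:}\tau.\rho[in_r^\sigma y/x]$, $|\Delta_1|=_\eta|\Delta_2|$, $\Gamma,x{:}\sigma\cup\tau\vdash_\Sigma\rho:\mathrm{Type}$; conversion: $\Delta:\tau$ if $\Delta:\sigma$, $\Gamma\vdash_\Sigma\tau:\mathrm{Type}$,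 $\sigma=_\Delta\tau$ (all judgements in the same $\Gamma$, $\Sigma$ unless stated). A term is strongly normalizing if it has no infinite $\to_\Delta$-reduction sequence; a pure $\lambda$-term is strongly normalizing if it has no infinite $\beta$-reduction sequence. -}

module Defs where

-- LF_Δ (Honsell–Liquori–et al.) with de Bruijn indices (terms up to α-conversion).
-- Variables are ℕ de Bruijn indices; family/object constants are named by ℕ.

open import Data.Nat using (ℕ; zero; suc)
open import Data.Product using (_×_)
open import Data.Unit using (⊤)
open import Data.List using (List; []; _∷_)
open import Data.List.Membership.Propositional using (_∈_; _∉_)
open import Data.List.Relation.Unary.All using (All)
open import Relation.Binary.PropositionalEquality using (_≡_)
open import Relation.Binary.Construct.Closure.Equivalence using (EqClosure)
open import Induction.WellFounded using (Acc)

data Kind : Set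
data Fam : Set
data Obj : Set

data Kind where
  type : Kind
  kΠ   : Fam → Kind → Kind          -- Π x:σ. K   (binds index 0 in K)

data Fam where
  fc   : ℕ → Fam
  fΠ   : Fam → Fam → Fam             -- Π x:σ. τ   (binds index 0 in τ)
  fapp : Fam → Obj → Fam
  _⇒ʳ_ : Fam → Fam → Fam
  _∩_  : Fam → Fam → Fam
  _∪_  : Fam → Fam → Fam

data Obj where
  oc     : ℕ → Obj
  var    : ℕ → Obj
  lam    : Fam → Obj → Obj           -- λ x:σ. Δ   (binds index 0)
  app    : Obj → Obj → Obj
  lamr   : Fam → Obj → Obj           -- λ^r x:σ. Δ (binds index 0)
  appr   : Obj → Obj → Obj
  pair   : Obj → Obj → Obj
  copair : Obj → Obj → Obj
  prl    : Obj → Obj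
  prr    : Obj → Obj
  inl    : Fam → Obj → Obj
  inr    : Fam → Obj → Obj

Ren : Set
Ren = ℕ → ℕ

ext : Ren → Ren
ext ρ zero    = zero
ext ρ (suc n) = suc (ρ n)

renK : Ren → Kind → Kind
renF : Ren → Fam → Fam
renO : Ren → Obj → Obj

renK ρ type       = type
renK ρ (kΠ σ K)   = kΠ (renF ρ σ) (renK (ext ρ) K)

renF ρ (fc a)     = fc a
renF ρ (fΠ σ τ)   = fΠ (renF ρ σ) (renF (ext ρ) τ)
renF ρ (fapp σ M) = fapp (renF ρ σ) (renO ρ M)
renF ρ (σ ⇒ʳ τ)   = renF ρ σ ⇒ʳ renF ρ τ
renF ρ (σ ∩ τ)    = renF ρ σ ∩ renF ρ τ
renF ρ (σ ∪ τ)    = renF ρ σ ∪ renF ρ τ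

renO ρ (oc c)       = oc c
renO ρ (var x)      = var (ρ x)
renO ρ (lam σ M)    = lam (renF ρ σ) (renO (ext ρ) M)
renO ρ (app M N)    = app (renO ρ M) (renO ρ N)
renO ρ (lamr σ M)   = lamr (renF ρ σ) (renO (ext ρ) M)
renO ρ (appr M N)   = appr (renO ρ M) (renO ρ N)
renO ρ (pair M N)   = pair (renO ρ M) (renO ρ N)
renO ρ (copair M N) = copair (renO ρ M) (renO ρ N)
renO ρ (prl M)      = prl (renO ρ M)
renO ρ (prr M)      = prr (renO ρ M)
renO ρ (inl σ M)    = inl (renF ρ σ) (renO ρ M)
renO ρ (inr σ M)    = inr (renF ρ σ) (renO ρ M)

Sub : Set
Sub = ℕ → Obj

exts : Sub → Sub
exts s zero    = var zero
exts s (suc n) = renO suc (s n)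

subK : Sub → Kind → Kind
subF : Sub → Fam → Fam
subO : Sub → Obj → Obj

subK s type       = type
subK s (kΠ σ K)   = kΠ (subF s σ) (subK (exts s) K)

subF s (fc a)     = fc a
subF s (fΠ σ τ)   = fΠ (subF s σ) (subF (exts s) τ)
subF s (fapp σ M) = fapp (subF s σ) (subO s M)
subF s (σ ⇒ʳ τ)   = subF s σ ⇒ʳ subF s τ
subF s (σ ∩ τ)    = subF s σ ∩ subF s τ
subF s (σ ∪ τ)    = subF s σ ∪ subF s τ

subO s (oc c)       = oc c
subO s (var x)      = s x
subO s (lam σ M)    = lam (subF s σ) (subO (exts s) M)
subO s (app M N)    = app (subO s M) (subO s N)
subO s (lamr σ M)   = lamr (subF s σ) (subO (exts s) M)
subO s (appr M N)   = appr (subO s M) (subO s N)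
subO s (pair M N)   = pair (subO s M) (subO s N)
subO s (copair M N) = copair (subO s M) (subO s N)
subO s (prl M)      = prl (subO s M)
subO s (prr M)      = prr (subO s M)
subO s (inl σ M)    = inl (subF s σ) (subO s M)
subO s (inr σ M)    = inr (subF s σ) (subO s M)

sub0 : Obj → Sub
sub0 N zero    = N
sub0 N (suc n) = var n

_[_]K : Kind → Obj → Kind
K [ N ]K = subK (sub0 N) K

_[_]F : Fam → Obj → Fam
σ [ N ]F = subF (sub0 N) σ

_[_]O : Obj → Obj → Obj
M [ N ]O = subO (sub0 N) M

-- ρ[in_l^τ y / x] : ρ under binder x  ↦  result under binder y
inlSub : Fam → Sub
inlSub τ zero    = inl (renF suc τ) (var zero)
inlSub τ (suc n) = var (suc n)

inrSub : Fam → Sub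
inrSub σ zero    = inr (renF suc σ) (var zero)
inrSub σ (suc n) = var (suc n)

-- Pure λ-terms (with constants, which arise as essences of constants)

data Λ : Set where
  cst : ℕ → Λ
  v   : ℕ → Λ
  ƛ   : Λ → Λ
  _·_ : Λ → Λ → Λ

renΛ : Ren → Λ → Λ
renΛ ρ (cst c) = cst c
renΛ ρ (v x)   = v (ρ x)
renΛ ρ (ƛ M)   = ƛ (renΛ (ext ρ) M)
renΛ ρ (M · N) = renΛ ρ M · renΛ ρ N

extsΛ : (ℕ → Λ) → (ℕ → Λ)
extsΛ s zero    = v zero
extsΛ s (suc n) = renΛ suc (s n)

subΛ : (ℕ → Λ) → Λ → Λ
subΛ s (cst c) = cst c
subΛ s (v x)   = s x
subΛ s (ƛ M)   = ƛ (subΛ (extsΛ s) M)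
subΛ s (M · N) = subΛ s M · subΛ s N

sub0Λ : Λ → ℕ → Λ
sub0Λ N zero    = N
sub0Λ N (suc n) = v n

data _→β_ : Λ → Λ → Set where
  β    : ∀ {M N} → (ƛ M · N) →β subΛ (sub0Λ N) M
  ξƛ   : ∀ {M M'} → M →β M' → ƛ M →β ƛ M'
  ξ·ₗ  : ∀ {M M' N} → M →β M' → (M · N) →β (M' · N)
  ξ·ᵣ  : ∀ {M N N'} → N →β N' → (M · N) →β (M · N')

-- one-step η-reduction: λx. M x → M  (x ∉ FV M, expressed by M being a weakening)
data _→η_ : Λ → Λ → Set where
  η    : ∀ {M} → ƛ (renΛ suc M · v zero) →η M
  ξƛ   : ∀ {M M'} → M →η M' → ƛ M →η ƛ M'
  ξ·ₗ  : ∀ {M M' N} → M →η M' → (M · N) →η (M' · N)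
  ξ·ᵣ  : ∀ {M N N'} → N →η N' → (M · N) →η (M · N')

_=η_ : Λ → Λ → Set
_=η_ = EqClosure _→η_

SNβ : Λ → Set
SNβ = Acc (λ N M → M →β N)

∣_∣ : Obj → Λ
∣ oc c ∣       = cst c
∣ var x ∣      = v x
∣ lam σ M ∣    = ƛ ∣ M ∣
∣ app M N ∣    = ∣ M ∣ · ∣ N ∣
∣ lamr σ M ∣   = ƛ ∣ M ∣
∣ appr M N ∣   = ∣ N ∣
∣ pair M N ∣   = ∣ M ∣
∣ copair M N ∣ = ∣ M ∣
∣ prl M ∣      = ∣ M ∣
∣ prr M ∣      = ∣ M ∣
∣ inl σ M ∣    = ∣ M ∣
∣ inr σ M ∣    = ∣ M ∣

data _⟶K_ : Kind → Kind → Set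
data _⟶F_ : Fam → Fam → Set
data _⟶O_ : Obj → Obj → Set

data _⟶K_ where
  kΠ₁ : ∀ {σ σ' K} → σ ⟶F σ' → kΠ σ K ⟶K kΠ σ' K
  kΠ₂ : ∀ {σ K K'} → K ⟶K K' → kΠ σ K ⟶K kΠ σ K'

data _⟶F_ where
  fΠ₁   : ∀ {σ σ' τ} → σ ⟶F σ' → fΠ σ τ ⟶F fΠ σ' τ
  fΠ₂   : ∀ {σ τ τ'} → τ ⟶F τ' → fΠ σ τ ⟶F fΠ σ τ'
  fapp₁ : ∀ {σ σ' M} → σ ⟶F σ' → fapp σ M ⟶F fapp σ' M
  fapp₂ : ∀ {σ M M'} → M ⟶O M' → fapp σ M ⟶F fapp σ M'
  ⇒₁    : ∀ {σ σ' τ} → σ ⟶F σ' → (σ ⇒ʳ τ) ⟶F (σ' ⇒ʳ τ)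
  ⇒₂    : ∀ {σ τ τ'} → τ ⟶F τ' → (σ ⇒ʳ τ) ⟶F (σ ⇒ʳ τ')
  ∩₁    : ∀ {σ σ' τ} → σ ⟶F σ' → (σ ∩ τ) ⟶F (σ' ∩ τ)
  ∩₂    : ∀ {σ τ τ'} → τ ⟶F τ' → (σ ∩ τ) ⟶F (σ ∩ τ')
  ∪₁    : ∀ {σ σ' τ} → σ ⟶F σ' → (σ ∪ τ) ⟶F (σ' ∪ τ)
  ∪₂    : ∀ {σ τ τ'} → τ ⟶F τ' → (σ ∪ τ) ⟶F (σ ∪ τ')

data _⟶O_ where
  β-λ    : ∀ {σ M N} → app (lam σ M) N ⟶O (M [ N ]O)
  β-prl  : ∀ {M N} → prl (pair M N) ⟶O M
  β-prr  : ∀ {M N} → prr (pair M N) ⟶O N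
  β-inl  : ∀ {M N σ P} → app (copair M N) (inl σ P) ⟶O app M P
  β-inr  : ∀ {M N σ P} → app (copair M N) (inr σ P) ⟶O app N P
  β-λʳ   : ∀ {σ M N} → appr (lamr σ M) N ⟶O (M [ N ]O)
  lam₁    : ∀ {σ σ' M} → σ ⟶F σ' → lam σ M ⟶O lam σ' M
  lam₂    : ∀ {σ M M'} → M ⟶O M' → lam σ M ⟶O lam σ M'
  app₁    : ∀ {M M' N} → M ⟶O M' → app M N ⟶O app M' N
  app₂    : ∀ {M N N'} → N ⟶O N' → app M N ⟶O app M N'
  lamr₁   : ∀ {σ σ' M} → σ ⟶F σ' → lamr σ M ⟶O lamr σ' M
  lamr₂   : ∀ {σ M M'} → M ⟶O M' → lamr σ M ⟶O lamr σ M'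
  appr₁   : ∀ {M M' N} → M ⟶O M' → appr M N ⟶O appr M' N
  appr₂   : ∀ {M N N'} → N ⟶O N' → appr M N ⟶O appr M N'
  pair₁₂  : ∀ {M M' N N'} → M ⟶O M' → N ⟶O N' → ∣ M' ∣ ≡ ∣ N' ∣ →
            pair M N ⟶O pair M' N'
  copair₁₂ : ∀ {M M' N N'} → M ⟶O M' → N ⟶O N' → ∣ M' ∣ ≡ ∣ N' ∣ →
            copair M N ⟶O copair M' N'
  prl₁    : ∀ {M M'} → M ⟶O M' → prl M ⟶O prl M'
  prr₁    : ∀ {M M'} → M ⟶O M' → prr M ⟶O prr M'
  inl₁    : ∀ {σ σ' M} → σ ⟶F σ' → inl σ M ⟶O inl σ' M
  inl₂    : ∀ {σ M M'} → M ⟶O M' → inl σ M ⟶O inl σ M'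
  inr₁    : ∀ {σ σ' M} → σ ⟶F σ' → inr σ M ⟶O inr σ' M
  inr₂    : ∀ {σ M M'} → M ⟶O M' → inr σ M ⟶O inr σ M'

_=K_ : Kind → Kind → Set
_=K_ = EqClosure _⟶K_

_=F_ : Fam → Fam → Set
_=F_ = EqClosure _⟶F_

SNK : Kind → Set
SNK = Acc (λ K' K → K ⟶K K')

SNF : Fam → Set
SNF = Acc (λ σ' σ → σ ⟶F σ')

SNO : Obj → Set
SNO = Acc (λ N M → M ⟶O N)

-- "Pairs/co-pairs are only considered when their components have
-- identical essences": the pseudo-term well-formedness predicate

CohK : Kind → Set
CohF : Fam → Set
CohO : Obj → Set

CohK type     = ⊤
CohK (kΠ σ K) = CohF σ × CohK K

CohF (fc a)     = ⊤
CohF (fΠ σ τ)   = CohF σ × CohF τ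
CohF (fapp σ M) = CohF σ × CohO M
CohF (σ ⇒ʳ τ)   = CohF σ × CohF τ
CohF (σ ∩ τ)    = CohF σ × CohF τ
CohF (σ ∪ τ)    = CohF σ × CohF τ

CohO (oc c)       = ⊤
CohO (var x)      = ⊤
CohO (lam σ M)    = CohF σ × CohO M
CohO (app M N)    = CohO M × CohO N
CohO (lamr σ M)   = CohF σ × CohO M
CohO (appr M N)   = CohO M × CohO N
CohO (pair M N)   = CohO M × CohO N × ∣ M ∣ ≡ ∣ N ∣
CohO (copair M N) = CohO M × CohO N × ∣ M ∣ ≡ ∣ N ∣
CohO (prl M)      = CohO M
CohO (prr M)      = CohO M
CohO (inl σ M)    = CohF σ × CohO M
CohO (inr σ M)    = CohF σ × CohO M

data Decl : Set where
  fdecl : ℕ → Kind → Decl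
  odecl : ℕ → Fam → Decl

-- most recent declaration first
Sig : Set
Sig = List Decl

data Name : Set where
  fname : ℕ → Name
  oname : ℕ → Name

dom : Sig → List Name
dom []              = []
dom (fdecl a K ∷ S) = fname a ∷ dom S
dom (odecl c σ ∷ S) = oname c ∷ dom S

CohDecl : Decl → Set
CohDecl (fdecl a K) = CohK K
CohDecl (odecl c σ) = CohF σ

CohSig : Sig → Set
CohSig = All CohDecl

-- contexts: most recent variable first; entry i is scoped in the tail
Ctx : Set
Ctx = List Fam

CohCtx : Ctx → Set
CohCtx = All CohF

data _∋_∶_ : Ctx → ℕ → Fam → Set where
  here  : ∀ {Γ σ} → (σ ∷ Γ) ∋ zero ∶ renF suc σ
  there : ∀ {Γ σ τ x} → Γ ∋ x ∶ σ → (τ ∷ Γ) ∋ suc x ∶ renF suc σ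

data ⊢Sig_ : Sig → Set
data ⊢Ctx[_]_ : Sig → Ctx → Set
data _⊢[_]K_ : Ctx → Sig → Kind → Set
data _⊢[_]F_∶_ : Ctx → Sig → Fam → Kind → Set
data _⊢[_]O_∶_ : Ctx → Sig → Obj → Fam → Set

data ⊢Sig_ where
  s-empty : ⊢Sig []
  s-fam   : ∀ {S a K} → ⊢Sig S → [] ⊢[ S ]K K → fname a ∉ dom S →
            ⊢Sig (fdecl a K ∷ S)
  s-obj   : ∀ {S c σ} → ⊢Sig S → [] ⊢[ S ]F σ ∶ type → oname c ∉ dom S →
            ⊢Sig (odecl c σ ∷ S)

data ⊢Ctx[_]_ where
  c-empty : ∀ {S} → ⊢Sig S → ⊢Ctx[ S ] []
  c-ext   : ∀ {S Γ σ} → ⊢Ctx[ S ] Γ → Γ ⊢[ S ]F σ ∶ type → ⊢Ctx[ S ] (σ ∷ Γ)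

data _⊢[_]K_ where
  k-type : ∀ {S Γ} → ⊢Ctx[ S ] Γ → Γ ⊢[ S ]K type
  k-Π    : ∀ {S Γ σ K} → (σ ∷ Γ) ⊢[ S ]K K → Γ ⊢[ S ]K kΠ σ K

data _⊢[_]F_∶_ where
  f-const : ∀ {S Γ a K} → ⊢Ctx[ S ] Γ → fdecl a K ∈ S → Γ ⊢[ S ]F fc a ∶ K
  f-Π     : ∀ {S Γ σ τ} → (σ ∷ Γ) ⊢[ S ]F τ ∶ type → Γ ⊢[ S ]F fΠ σ τ ∶ type
  f-app   : ∀ {S Γ σ τ K M} → Γ ⊢[ S ]F σ ∶ kΠ τ K → Γ ⊢[ S ]O M ∶ τ →
            Γ ⊢[ S ]F fapp σ M ∶ (K [ M ]K)
  f-⇒     : ∀ {S Γ σ τ} → Γ ⊢[ S ]F σ ∶ type → Γ ⊢[ S ]F τ ∶ type →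
            Γ ⊢[ S ]F (σ ⇒ʳ τ) ∶ type
  f-∩     : ∀ {S Γ σ τ} → Γ ⊢[ S ]F σ ∶ type → Γ ⊢[ S ]F τ ∶ type →
            Γ ⊢[ S ]F (σ ∩ τ) ∶ type
  f-∪     : ∀ {S Γ σ τ} → Γ ⊢[ S ]F σ ∶ type → Γ ⊢[ S ]F τ ∶ type →
            Γ ⊢[ S ]F (σ ∪ τ) ∶ type
  f-conv  : ∀ {S Γ σ K₁ K₂} → Γ ⊢[ S ]F σ ∶ K₁ → Γ ⊢[ S ]K K₂ → K₁ =K K₂ →
            Γ ⊢[ S ]F σ ∶ K₂

data _⊢[_]O_∶_ where
  o-const  : ∀ {S Γ c σ} → ⊢Ctx[ S ] Γ → odecl c σ ∈ S → Γ ⊢[ S ]O oc c ∶ σ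
  o-var    : ∀ {S Γ x σ} → ⊢Ctx[ S ] Γ → Γ ∋ x ∶ σ → Γ ⊢[ S ]O var x ∶ σ
  o-lam    : ∀ {S Γ σ τ M} → (σ ∷ Γ) ⊢[ S ]O M ∶ τ → Γ ⊢[ S ]O lam σ M ∶ fΠ σ τ
  o-app    : ∀ {S Γ σ τ M N} → Γ ⊢[ S ]O M ∶ fΠ σ τ → Γ ⊢[ S ]O N ∶ σ →
             Γ ⊢[ S ]O app M N ∶ (τ [ N ]F)
  -- τ does not depend on x, hence appears weakened in the premise
  o-lamr   : ∀ {S Γ σ τ M} → (σ ∷ Γ) ⊢[ S ]O M ∶ renF suc τ → ∣ M ∣ =η v zero →
             Γ ⊢[ S ]O lamr σ M ∶ (σ ⇒ʳ τ)
  o-appr   : ∀ {S Γ σ τ M N} → Γ ⊢[ S ]O M ∶ (σ ⇒ʳ τ) → Γ ⊢[ S ]O N ∶ σ →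
             Γ ⊢[ S ]O appr M N ∶ τ
  o-pair   : ∀ {S Γ σ τ M N} → Γ ⊢[ S ]O M ∶ σ → Γ ⊢[ S ]O N ∶ τ → ∣ M ∣ =η ∣ N ∣ →
             Γ ⊢[ S ]O pair M N ∶ (σ ∩ τ)
  o-prl    : ∀ {S Γ σ τ M} → Γ ⊢[ S ]O M ∶ (σ ∩ τ) → Γ ⊢[ S ]O prl M ∶ σ
  o-prr    : ∀ {S Γ σ τ M} → Γ ⊢[ S ]O M ∶ (σ ∩ τ) → Γ ⊢[ S ]O prr M ∶ τ
  o-inl    : ∀ {S Γ σ τ M} → Γ ⊢[ S ]O M ∶ σ → Γ ⊢[ S ]F (σ ∪ τ) ∶ type →
             Γ ⊢[ S ]O inl τ M ∶ (σ ∪ τ)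
  o-inr    : ∀ {S Γ σ τ M} → Γ ⊢[ S ]O M ∶ τ → Γ ⊢[ S ]F (σ ∪ τ) ∶ type →
             Γ ⊢[ S ]O inr σ M ∶ (σ ∪ τ)
  o-copair : ∀ {S Γ σ τ ρ M N} →
             Γ ⊢[ S ]O M ∶ fΠ σ (subF (inlSub τ) ρ) →
             Γ ⊢[ S ]O N ∶ fΠ τ (subF (inrSub σ) ρ) →
             ∣ M ∣ =η ∣ N ∣ →
             ((σ ∪ τ) ∷ Γ) ⊢[ S ]F ρ ∶ type →
             Γ ⊢[ S ]O copair M N ∶ fΠ (σ ∪ τ) ρ
  o-conv   : ∀ {S Γ σ τ M} → Γ ⊢[ S ]O M ∶ σ → Γ ⊢[ S ]F τ ∶ type → σ =F τ →
             Γ ⊢[ S ]O M ∶ τ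

-- (1) Girard's reducibility method with candidates indexed by simple types: erasing the
-- object arguments of a family gives a simple type invariant under substitution and
-- Δ-conversion, so the dependency of types on objects can be ignored.  Pairs and co-pairs
-- reduce componentwise, so ∩, ∪ and →ʳ get the candidates of products, sums and arrows.
--
-- (2) A strongly normalising λ-term is typable with intersection types (without ω), by
-- well-founded induction on reduction together with the subterm relation: head normal
-- forms are typed directly, head redexes by subject expansion.  Such a derivation is read
-- as an LF_Δ object whose essence is the term: ∩-introduction becomes a pair and
-- subtyping becomes a chain of projections and pairings, none of which changes the essence.

module Submission where

open import Defs
open import Data.Nat using (ℕ; zero; suc; _<_; _≤_; _⊔_; s≤s; _≟_)
open import Data.Nat.Properties using (≤-refl; ≤-trans; m≤m⊔n; m≤n⊔m; n≤1+n; <-irrefl; ≤∧≢⇒<)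
open import Data.Product using (Σ; Σ-syntax; _×_; _,_; proj₁; proj₂)
open import Data.Sum using (_⊎_; inj₁; inj₂)
open import Data.Unit using (⊤; tt)
open import Data.Empty using (⊥; ⊥-elim)
open import Data.List using (List; []; _∷_)
open import Data.List.Relation.Unary.Any using (here; there)
open import Data.List.Relation.Unary.All using ([]; _∷_)
open import Data.List.Membership.Propositional using (_∈_; _∉_)
open import Relation.Binary.PropositionalEquality
open import Relation.Binary.Construct.Closure.ReflexiveTransitive using (Star; ε; _◅_)
open import Relation.Binary.Construct.Closure.Symmetric using (fwd; bwd)
import Relation.Binary.Construct.On as On
open import Relation.Nullary using (yes; no)
open import Induction.WellFounded using (Acc; acc; module Subrelation)
open import Function using (_∘_)

-- Substitution algebra

ext-cong : ∀ {ρ ρ′} → ρ ≗ ρ′ → ext ρ ≗ ext ρ′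
ext-cong e zero    = refl
ext-cong e (suc n) = cong suc (e n)

renF-cong : ∀ {ρ ρ′} → ρ ≗ ρ′ → ∀ σ → renF ρ σ ≡ renF ρ′ σ
renO-cong : ∀ {ρ ρ′} → ρ ≗ ρ′ → ∀ M → renO ρ M ≡ renO ρ′ M
renF-cong e (fc a)       = refl
renF-cong e (fΠ σ τ)     = cong₂ fΠ (renF-cong e σ) (renF-cong (ext-cong e) τ)
renF-cong e (fapp σ M)   = cong₂ fapp (renF-cong e σ) (renO-cong e M)
renF-cong e (σ ⇒ʳ τ)     = cong₂ _⇒ʳ_ (renF-cong e σ) (renF-cong e τ)
renF-cong e (σ ∩ τ)      = cong₂ _∩_ (renF-cong e σ) (renF-cong e τ)
renF-cong e (σ ∪ τ)      = cong₂ _∪_ (renF-cong e σ) (renF-cong e τ)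
renO-cong e (oc c)       = refl
renO-cong e (var x)      = cong var (e x)
renO-cong e (lam σ M)    = cong₂ lam (renF-cong e σ) (renO-cong (ext-cong e) M)
renO-cong e (app M N)    = cong₂ app (renO-cong e M) (renO-cong e N)
renO-cong e (lamr σ M)   = cong₂ lamr (renF-cong e σ) (renO-cong (ext-cong e) M)
renO-cong e (appr M N)   = cong₂ appr (renO-cong e M) (renO-cong e N)
renO-cong e (pair M N)   = cong₂ pair (renO-cong e M) (renO-cong e N)
renO-cong e (copair M N) = cong₂ copair (renO-cong e M) (renO-cong e N)
renO-cong e (prl M)      = cong prl (renO-cong e M)
renO-cong e (prr M)      = cong prr (renO-cong e M)
renO-cong e (inl σ M)    = cong₂ inl (renF-cong e σ) (renO-cong e M)
renO-cong e (inr σ M)    = cong₂ inr (renF-cong e σ) (renO-cong e M)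

exts-cong : ∀ {s s′} → s ≗ s′ → exts s ≗ exts s′
exts-cong e zero    = refl
exts-cong e (suc n) = cong (renO suc) (e n)

subK-cong : ∀ {s s′} → s ≗ s′ → ∀ K → subK s K ≡ subK s′ K
subF-cong : ∀ {s s′} → s ≗ s′ → ∀ σ → subF s σ ≡ subF s′ σ
subO-cong : ∀ {s s′} → s ≗ s′ → ∀ M → subO s M ≡ subO s′ M
subK-cong e type         = refl
subK-cong e (kΠ σ K)     = cong₂ kΠ (subF-cong e σ) (subK-cong (exts-cong e) K)
subF-cong e (fc a)       = refl
subF-cong e (fΠ σ τ)     = cong₂ fΠ (subF-cong e σ) (subF-cong (exts-cong e) τ)
subF-cong e (fapp σ M)   = cong₂ fapp (subF-cong e σ) (subO-cong e M)
subF-cong e (σ ⇒ʳ τ)     = cong₂ _⇒ʳ_ (subF-cong e σ) (subF-cong e τ)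
subF-cong e (σ ∩ τ)      = cong₂ _∩_ (subF-cong e σ) (subF-cong e τ)
subF-cong e (σ ∪ τ)      = cong₂ _∪_ (subF-cong e σ) (subF-cong e τ)
subO-cong e (oc c)       = refl
subO-cong e (var x)      = e x
subO-cong e (lam σ M)    = cong₂ lam (subF-cong e σ) (subO-cong (exts-cong e) M)
subO-cong e (app M N)    = cong₂ app (subO-cong e M) (subO-cong e N)
subO-cong e (lamr σ M)   = cong₂ lamr (subF-cong e σ) (subO-cong (exts-cong e) M)
subO-cong e (appr M N)   = cong₂ appr (subO-cong e M) (subO-cong e N)
subO-cong e (pair M N)   = cong₂ pair (subO-cong e M) (subO-cong e N)
subO-cong e (copair M N) = cong₂ copair (subO-cong e M) (subO-cong e N)
subO-cong e (prl M)      = cong prl (subO-cong e M)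
subO-cong e (prr M)      = cong prr (subO-cong e M)
subO-cong e (inl σ M)    = cong₂ inl (subF-cong e σ) (subO-cong e M)
subO-cong e (inr σ M)    = cong₂ inr (subF-cong e σ) (subO-cong e M)

ext-∘ : ∀ ρ ρ′ → ext (ρ ∘ ρ′) ≗ ext ρ ∘ ext ρ′
ext-∘ ρ ρ′ zero    = refl
ext-∘ ρ ρ′ (suc n) = refl

renF-renF : ∀ ρ ρ′ σ → renF ρ (renF ρ′ σ) ≡ renF (ρ ∘ ρ′) σ
renO-renO : ∀ ρ ρ′ M → renO ρ (renO ρ′ M) ≡ renO (ρ ∘ ρ′) M
renF-renF ρ ρ′ (fc a)       = refl
renF-renF ρ ρ′ (fΠ σ τ)     =
  cong₂ fΠ (renF-renF ρ ρ′ σ) (trans (renF-renF (ext ρ) (ext ρ′) τ) (sym (renF-cong (ext-∘ ρ ρ′) τ)))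
renF-renF ρ ρ′ (fapp σ M)   = cong₂ fapp (renF-renF ρ ρ′ σ) (renO-renO ρ ρ′ M)
renF-renF ρ ρ′ (σ ⇒ʳ τ)     = cong₂ _⇒ʳ_ (renF-renF ρ ρ′ σ) (renF-renF ρ ρ′ τ)
renF-renF ρ ρ′ (σ ∩ τ)      = cong₂ _∩_ (renF-renF ρ ρ′ σ) (renF-renF ρ ρ′ τ)
renF-renF ρ ρ′ (σ ∪ τ)      = cong₂ _∪_ (renF-renF ρ ρ′ σ) (renF-renF ρ ρ′ τ)
renO-renO ρ ρ′ (oc c)       = refl
renO-renO ρ ρ′ (var x)      = refl
renO-renO ρ ρ′ (lam σ M)    =
  cong₂ lam (renF-renF ρ ρ′ σ) (trans (renO-renO (ext ρ) (ext ρ′) M) (sym (renO-cong (ext-∘ ρ ρ′) M)))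
renO-renO ρ ρ′ (app M N)    = cong₂ app (renO-renO ρ ρ′ M) (renO-renO ρ ρ′ N)
renO-renO ρ ρ′ (lamr σ M)   =
  cong₂ lamr (renF-renF ρ ρ′ σ) (trans (renO-renO (ext ρ) (ext ρ′) M) (sym (renO-cong (ext-∘ ρ ρ′) M)))
renO-renO ρ ρ′ (appr M N)   = cong₂ appr (renO-renO ρ ρ′ M) (renO-renO ρ ρ′ N)
renO-renO ρ ρ′ (pair M N)   = cong₂ pair (renO-renO ρ ρ′ M) (renO-renO ρ ρ′ N)
renO-renO ρ ρ′ (copair M N) = cong₂ copair (renO-renO ρ ρ′ M) (renO-renO ρ ρ′ N)
renO-renO ρ ρ′ (prl M)      = cong prl (renO-renO ρ ρ′ M)
renO-renO ρ ρ′ (prr M)      = cong prr (renO-renO ρ ρ′ M)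
renO-renO ρ ρ′ (inl σ M)    = cong₂ inl (renF-renF ρ ρ′ σ) (renO-renO ρ ρ′ M)
renO-renO ρ ρ′ (inr σ M)    = cong₂ inr (renF-renF ρ ρ′ σ) (renO-renO ρ ρ′ M)

exts-ext : ∀ s ρ → exts s ∘ ext ρ ≗ exts (s ∘ ρ)
exts-ext s ρ zero    = refl
exts-ext s ρ (suc n) = refl

subF-renF : ∀ s ρ σ → subF s (renF ρ σ) ≡ subF (s ∘ ρ) σ
subO-renO : ∀ s ρ M → subO s (renO ρ M) ≡ subO (s ∘ ρ) M
subF-renF s ρ (fc a)       = refl
subF-renF s ρ (fΠ σ τ)     =
  cong₂ fΠ (subF-renF s ρ σ) (trans (subF-renF (exts s) (ext ρ) τ) (subF-cong (exts-ext s ρ) τ))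
subF-renF s ρ (fapp σ M)   = cong₂ fapp (subF-renF s ρ σ) (subO-renO s ρ M)
subF-renF s ρ (σ ⇒ʳ τ)     = cong₂ _⇒ʳ_ (subF-renF s ρ σ) (subF-renF s ρ τ)
subF-renF s ρ (σ ∩ τ)      = cong₂ _∩_ (subF-renF s ρ σ) (subF-renF s ρ τ)
subF-renF s ρ (σ ∪ τ)      = cong₂ _∪_ (subF-renF s ρ σ) (subF-renF s ρ τ)
subO-renO s ρ (oc c)       = refl
subO-renO s ρ (var x)      = refl
subO-renO s ρ (lam σ M)    =
  cong₂ lam (subF-renF s ρ σ) (trans (subO-renO (exts s) (ext ρ) M) (subO-cong (exts-ext s ρ) M))
subO-renO s ρ (app M N)    = cong₂ app (subO-renO s ρ M) (subO-renO s ρ N)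
subO-renO s ρ (lamr σ M)   =
  cong₂ lamr (subF-renF s ρ σ) (trans (subO-renO (exts s) (ext ρ) M) (subO-cong (exts-ext s ρ) M))
subO-renO s ρ (appr M N)   = cong₂ appr (subO-renO s ρ M) (subO-renO s ρ N)
subO-renO s ρ (pair M N)   = cong₂ pair (subO-renO s ρ M) (subO-renO s ρ N)
subO-renO s ρ (copair M N) = cong₂ copair (subO-renO s ρ M) (subO-renO s ρ N)
subO-renO s ρ (prl M)      = cong prl (subO-renO s ρ M)
subO-renO s ρ (prr M)      = cong prr (subO-renO s ρ M)
subO-renO s ρ (inl σ M)    = cong₂ inl (subF-renF s ρ σ) (subO-renO s ρ M)
subO-renO s ρ (inr σ M)    = cong₂ inr (subF-renF s ρ σ) (subO-renO s ρ M)

ext-exts : ∀ ρ s → renO (ext ρ) ∘ exts s ≗ exts (renO ρ ∘ s)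
ext-exts ρ s zero    = refl
ext-exts ρ s (suc n) = trans (renO-renO (ext ρ) suc (s n)) (sym (renO-renO suc ρ (s n)))

renF-subF : ∀ ρ s σ → renF ρ (subF s σ) ≡ subF (renO ρ ∘ s) σ
renO-subO : ∀ ρ s M → renO ρ (subO s M) ≡ subO (renO ρ ∘ s) M
renF-subF ρ s (fc a)       = refl
renF-subF ρ s (fΠ σ τ)     =
  cong₂ fΠ (renF-subF ρ s σ) (trans (renF-subF (ext ρ) (exts s) τ) (subF-cong (ext-exts ρ s) τ))
renF-subF ρ s (fapp σ M)   = cong₂ fapp (renF-subF ρ s σ) (renO-subO ρ s M)
renF-subF ρ s (σ ⇒ʳ τ)     = cong₂ _⇒ʳ_ (renF-subF ρ s σ) (renF-subF ρ s τ)
renF-subF ρ s (σ ∩ τ)      = cong₂ _∩_ (renF-subF ρ s σ) (renF-subF ρ s τ)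
renF-subF ρ s (σ ∪ τ)      = cong₂ _∪_ (renF-subF ρ s σ) (renF-subF ρ s τ)
renO-subO ρ s (oc c)       = refl
renO-subO ρ s (var x)      = refl
renO-subO ρ s (lam σ M)    =
  cong₂ lam (renF-subF ρ s σ) (trans (renO-subO (ext ρ) (exts s) M) (subO-cong (ext-exts ρ s) M))
renO-subO ρ s (app M N)    = cong₂ app (renO-subO ρ s M) (renO-subO ρ s N)
renO-subO ρ s (lamr σ M)   =
  cong₂ lamr (renF-subF ρ s σ) (trans (renO-subO (ext ρ) (exts s) M) (subO-cong (ext-exts ρ s) M))
renO-subO ρ s (appr M N)   = cong₂ appr (renO-subO ρ s M) (renO-subO ρ s N)
renO-subO ρ s (pair M N)   = cong₂ pair (renO-subO ρ s M) (renO-subO ρ s N)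
renO-subO ρ s (copair M N) = cong₂ copair (renO-subO ρ s M) (renO-subO ρ s N)
renO-subO ρ s (prl M)      = cong prl (renO-subO ρ s M)
renO-subO ρ s (prr M)      = cong prr (renO-subO ρ s M)
renO-subO ρ s (inl σ M)    = cong₂ inl (renF-subF ρ s σ) (renO-subO ρ s M)
renO-subO ρ s (inr σ M)    = cong₂ inr (renF-subF ρ s σ) (renO-subO ρ s M)

exts-exts : ∀ s t → subO (exts s) ∘ exts t ≗ exts (subO s ∘ t)
exts-exts s t zero    = refl
exts-exts s t (suc n) = trans (subO-renO (exts s) suc (t n)) (sym (renO-subO suc s (t n)))

subK-subK : ∀ s t K → subK s (subK t K) ≡ subK (subO s ∘ t) K
subF-subF : ∀ s t σ → subF s (subF t σ) ≡ subF (subO s ∘ t) σ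
subO-subO : ∀ s t M → subO s (subO t M) ≡ subO (subO s ∘ t) M
subK-subK s t type         = refl
subK-subK s t (kΠ σ K)     =
  cong₂ kΠ (subF-subF s t σ) (trans (subK-subK (exts s) (exts t) K) (subK-cong (exts-exts s t) K))
subF-subF s t (fc a)       = refl
subF-subF s t (fΠ σ τ)     =
  cong₂ fΠ (subF-subF s t σ) (trans (subF-subF (exts s) (exts t) τ) (subF-cong (exts-exts s t) τ))
subF-subF s t (fapp σ M)   = cong₂ fapp (subF-subF s t σ) (subO-subO s t M)
subF-subF s t (σ ⇒ʳ τ)     = cong₂ _⇒ʳ_ (subF-subF s t σ) (subF-subF s t τ)
subF-subF s t (σ ∩ τ)      = cong₂ _∩_ (subF-subF s t σ) (subF-subF s t τ)
subF-subF s t (σ ∪ τ)      = cong₂ _∪_ (subF-subF s t σ) (subF-subF s t τ)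
subO-subO s t (oc c)       = refl
subO-subO s t (var x)      = refl
subO-subO s t (lam σ M)    =
  cong₂ lam (subF-subF s t σ) (trans (subO-subO (exts s) (exts t) M) (subO-cong (exts-exts s t) M))
subO-subO s t (app M N)    = cong₂ app (subO-subO s t M) (subO-subO s t N)
subO-subO s t (lamr σ M)   =
  cong₂ lamr (subF-subF s t σ) (trans (subO-subO (exts s) (exts t) M) (subO-cong (exts-exts s t) M))
subO-subO s t (appr M N)   = cong₂ appr (subO-subO s t M) (subO-subO s t N)
subO-subO s t (pair M N)   = cong₂ pair (subO-subO s t M) (subO-subO s t N)
subO-subO s t (copair M N) = cong₂ copair (subO-subO s t M) (subO-subO s t N)
subO-subO s t (prl M)      = cong prl (subO-subO s t M)
subO-subO s t (prr M)      = cong prr (subO-subO s t M)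
subO-subO s t (inl σ M)    = cong₂ inl (subF-subF s t σ) (subO-subO s t M)
subO-subO s t (inr σ M)    = cong₂ inr (subF-subF s t σ) (subO-subO s t M)

exts-var : exts var ≗ var
exts-var zero    = refl
exts-var (suc n) = refl

subK-var : ∀ K → subK var K ≡ K
subF-var : ∀ σ → subF var σ ≡ σ
subO-var : ∀ M → subO var M ≡ M
subK-var type         = refl
subK-var (kΠ σ K)     = cong₂ kΠ (subF-var σ) (trans (subK-cong exts-var K) (subK-var K))
subF-var (fc a)       = refl
subF-var (fΠ σ τ)     = cong₂ fΠ (subF-var σ) (trans (subF-cong exts-var τ) (subF-var τ))
subF-var (fapp σ M)   = cong₂ fapp (subF-var σ) (subO-var M)
subF-var (σ ⇒ʳ τ)     = cong₂ _⇒ʳ_ (subF-var σ) (subF-var τ)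
subF-var (σ ∩ τ)      = cong₂ _∩_ (subF-var σ) (subF-var τ)
subF-var (σ ∪ τ)      = cong₂ _∪_ (subF-var σ) (subF-var τ)
subO-var (oc c)       = refl
subO-var (var x)      = refl
subO-var (lam σ M)    = cong₂ lam (subF-var σ) (trans (subO-cong exts-var M) (subO-var M))
subO-var (app M N)    = cong₂ app (subO-var M) (subO-var N)
subO-var (lamr σ M)   = cong₂ lamr (subF-var σ) (trans (subO-cong exts-var M) (subO-var M))
subO-var (appr M N)   = cong₂ appr (subO-var M) (subO-var N)
subO-var (pair M N)   = cong₂ pair (subO-var M) (subO-var N)
subO-var (copair M N) = cong₂ copair (subO-var M) (subO-var N)
subO-var (prl M)      = cong prl (subO-var M)
subO-var (prr M)      = cong prr (subO-var M)
subO-var (inl σ M)    = cong₂ inl (subF-var σ) (subO-var M)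
subO-var (inr σ M)    = cong₂ inr (subF-var σ) (subO-var M)

infixr 5 _∷ₛ_

_∷ₛ_ : Obj → Sub → Sub
(N ∷ₛ s) zero    = N
(N ∷ₛ s) (suc n) = s n

sub0-exts : ∀ N s → subO (sub0 N) ∘ exts s ≗ N ∷ₛ s
sub0-exts N s zero    = refl
sub0-exts N s (suc n) = trans (subO-renO (sub0 N) suc (s n)) (subO-var (s n))

exts-[]K : ∀ N s K → subK (exts s) K [ N ]K ≡ subK (N ∷ₛ s) K
exts-[]K N s K = trans (subK-subK (sub0 N) (exts s) K) (subK-cong (sub0-exts N s) K)

exts-[]F : ∀ N s σ → subF (exts s) σ [ N ]F ≡ subF (N ∷ₛ s) σ
exts-[]F N s σ = trans (subF-subF (sub0 N) (exts s) σ) (subF-cong (sub0-exts N s) σ)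

exts-[]O : ∀ N s M → subO (exts s) M [ N ]O ≡ subO (N ∷ₛ s) M
exts-[]O N s M = trans (subO-subO (sub0 N) (exts s) M) (subO-cong (sub0-exts N s) M)

subO-[]O : ∀ s M N → subO s (M [ N ]O) ≡ subO (exts s) M [ subO s N ]O
subO-[]O s M N = begin
  subO s (M [ N ]O)            ≡⟨ subO-subO s (sub0 N) M ⟩
  subO (subO s ∘ sub0 N) M     ≡⟨ subO-cong sub∘sub0 M ⟩
  subO (subO s N ∷ₛ s) M       ≡⟨ exts-[]O (subO s N) s M ⟨
  subO (exts s) M [ subO s N ]O ∎
  where
  open ≡-Reasoning
  sub∘sub0 : subO s ∘ sub0 N ≗ subO s N ∷ₛ s
  sub∘sub0 zero    = refl
  sub∘sub0 (suc n) = refl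

extsΛ-cong : ∀ {s s′} → s ≗ s′ → extsΛ s ≗ extsΛ s′
extsΛ-cong e zero    = refl
extsΛ-cong e (suc n) = cong (renΛ suc) (e n)

subΛ-cong : ∀ {s s′} → s ≗ s′ → ∀ M → subΛ s M ≡ subΛ s′ M
subΛ-cong e (cst c) = refl
subΛ-cong e (v x)   = e x
subΛ-cong e (ƛ M)   = cong ƛ (subΛ-cong (extsΛ-cong e) M)
subΛ-cong e (M · N) = cong₂ _·_ (subΛ-cong e M) (subΛ-cong e N)

∣renO∣ : ∀ ρ M → ∣ renO ρ M ∣ ≡ renΛ ρ ∣ M ∣
∣renO∣ ρ (oc c)       = refl
∣renO∣ ρ (var x)      = refl
∣renO∣ ρ (lam σ M)    = cong ƛ (∣renO∣ (ext ρ) M)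
∣renO∣ ρ (app M N)    = cong₂ _·_ (∣renO∣ ρ M) (∣renO∣ ρ N)
∣renO∣ ρ (lamr σ M)   = cong ƛ (∣renO∣ (ext ρ) M)
∣renO∣ ρ (appr M N)   = ∣renO∣ ρ N
∣renO∣ ρ (pair M N)   = ∣renO∣ ρ M
∣renO∣ ρ (copair M N) = ∣renO∣ ρ M
∣renO∣ ρ (prl M)      = ∣renO∣ ρ M
∣renO∣ ρ (prr M)      = ∣renO∣ ρ M
∣renO∣ ρ (inl σ M)    = ∣renO∣ ρ M
∣renO∣ ρ (inr σ M)    = ∣renO∣ ρ M

∣exts∣ : ∀ s → ∣_∣ ∘ exts s ≗ extsΛ (∣_∣ ∘ s)
∣exts∣ s zero    = refl
∣exts∣ s (suc n) = ∣renO∣ suc (s n)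

∣subO∣ : ∀ s M → ∣ subO s M ∣ ≡ subΛ (∣_∣ ∘ s) ∣ M ∣
∣subO∣ s (oc c)       = refl
∣subO∣ s (var x)      = refl
∣subO∣ s (lam σ M)    = cong ƛ (trans (∣subO∣ (exts s) M) (subΛ-cong (∣exts∣ s) ∣ M ∣))
∣subO∣ s (app M N)    = cong₂ _·_ (∣subO∣ s M) (∣subO∣ s N)
∣subO∣ s (lamr σ M)   = cong ƛ (trans (∣subO∣ (exts s) M) (subΛ-cong (∣exts∣ s) ∣ M ∣))
∣subO∣ s (appr M N)   = ∣subO∣ s N
∣subO∣ s (pair M N)   = ∣subO∣ s M
∣subO∣ s (copair M N) = ∣subO∣ s M
∣subO∣ s (prl M)      = ∣subO∣ s M
∣subO∣ s (prr M)      = ∣subO∣ s M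
∣subO∣ s (inl σ M)    = ∣subO∣ s M
∣subO∣ s (inr σ M)    = ∣subO∣ s M

subO-resp-∣∣ : ∀ s {M N} → ∣ M ∣ ≡ ∣ N ∣ → ∣ subO s M ∣ ≡ ∣ subO s N ∣
subO-resp-∣∣ s {M} {N} e = begin
  ∣ subO s M ∣               ≡⟨ ∣subO∣ s M ⟩
  subΛ (∣_∣ ∘ s) ∣ M ∣       ≡⟨ cong (subΛ (∣_∣ ∘ s)) e ⟩
  subΛ (∣_∣ ∘ s) ∣ N ∣       ≡⟨ ∣subO∣ s N ⟨
  ∣ subO s N ∣               ∎
  where open ≡-Reasoning

subK-⟶ : ∀ s {K K′} → K ⟶K K′ → subK s K ⟶K subK s K′
subF-⟶ : ∀ s {σ σ′} → σ ⟶F σ′ → subF s σ ⟶F subF s σ′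
subO-⟶ : ∀ s {M M′} → M ⟶O M′ → subO s M ⟶O subO s M′
subK-⟶ s (kΠ₁ r)  = kΠ₁ (subF-⟶ s r)
subK-⟶ s (kΠ₂ r)  = kΠ₂ (subK-⟶ (exts s) r)
subF-⟶ s (fΠ₁ r)  = fΠ₁ (subF-⟶ s r)
subF-⟶ s (fΠ₂ r)  = fΠ₂ (subF-⟶ (exts s) r)
subF-⟶ s (fapp₁ r) = fapp₁ (subF-⟶ s r)
subF-⟶ s (fapp₂ r) = fapp₂ (subO-⟶ s r)
subF-⟶ s (⇒₁ r)   = ⇒₁ (subF-⟶ s r)
subF-⟶ s (⇒₂ r)   = ⇒₂ (subF-⟶ s r)
subF-⟶ s (∩₁ r)   = ∩₁ (subF-⟶ s r)
subF-⟶ s (∩₂ r)   = ∩₂ (subF-⟶ s r)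
subF-⟶ s (∪₁ r)   = ∪₁ (subF-⟶ s r)
subF-⟶ s (∪₂ r)   = ∪₂ (subF-⟶ s r)
subO-⟶ s (β-λ {σ} {M} {N}) =
  subst (subO s (app (lam σ M) N) ⟶O_) (sym (subO-[]O s M N)) β-λ
subO-⟶ s β-prl = β-prl
subO-⟶ s β-prr = β-prr
subO-⟶ s β-inl = β-inl
subO-⟶ s β-inr = β-inr
subO-⟶ s (β-λʳ {σ} {M} {N}) =
  subst (subO s (appr (lamr σ M) N) ⟶O_) (sym (subO-[]O s M N)) β-λʳ
subO-⟶ s (lam₁ r)  = lam₁ (subF-⟶ s r)
subO-⟶ s (lam₂ r)  = lam₂ (subO-⟶ (exts s) r)
subO-⟶ s (app₁ r)  = app₁ (subO-⟶ s r)
subO-⟶ s (app₂ r)  = app₂ (subO-⟶ s r)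
subO-⟶ s (lamr₁ r) = lamr₁ (subF-⟶ s r)
subO-⟶ s (lamr₂ r) = lamr₂ (subO-⟶ (exts s) r)
subO-⟶ s (appr₁ r) = appr₁ (subO-⟶ s r)
subO-⟶ s (appr₂ r) = appr₂ (subO-⟶ s r)
subO-⟶ s (pair₁₂ {M' = M₁} {N' = N₁} r r′ e) =
  pair₁₂ (subO-⟶ s r) (subO-⟶ s r′) (subO-resp-∣∣ s {M₁} {N₁} e)
subO-⟶ s (copair₁₂ {M' = M₁} {N' = N₁} r r′ e) =
  copair₁₂ (subO-⟶ s r) (subO-⟶ s r′) (subO-resp-∣∣ s {M₁} {N₁} e)
subO-⟶ s (prl₁ r)  = prl₁ (subO-⟶ s r)
subO-⟶ s (prr₁ r)  = prr₁ (subO-⟶ s r)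
subO-⟶ s (inl₁ r)  = inl₁ (subF-⟶ s r)
subO-⟶ s (inl₂ r)  = inl₂ (subO-⟶ s r)
subO-⟶ s (inr₁ r)  = inr₁ (subF-⟶ s r)
subO-⟶ s (inr₂ r)  = inr₂ (subO-⟶ s r)

-- Strong normalisation of typable terms

data Ty : Set where
  base            : Ty
  pi arr prod sum : Ty → Ty → Ty

erase : Fam → Ty
erase (fc a)     = base
erase (fΠ σ τ)   = pi (erase σ) (erase τ)
erase (fapp σ M) = erase σ
erase (σ ⇒ʳ τ)   = arr (erase σ) (erase τ)
erase (σ ∩ τ)    = prod (erase σ) (erase τ)
erase (σ ∪ τ)    = sum (erase σ) (erase τ)

erase-subF : ∀ s σ → erase (subF s σ) ≡ erase σ
erase-subF s (fc a)     = refl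
erase-subF s (fΠ σ τ)   = cong₂ pi (erase-subF s σ) (erase-subF (exts s) τ)
erase-subF s (fapp σ M) = erase-subF s σ
erase-subF s (σ ⇒ʳ τ)   = cong₂ arr (erase-subF s σ) (erase-subF s τ)
erase-subF s (σ ∩ τ)    = cong₂ prod (erase-subF s σ) (erase-subF s τ)
erase-subF s (σ ∪ τ)    = cong₂ sum (erase-subF s σ) (erase-subF s τ)

erase-renF : ∀ ρ σ → erase (renF ρ σ) ≡ erase σ
erase-renF ρ (fc a)     = refl
erase-renF ρ (fΠ σ τ)   = cong₂ pi (erase-renF ρ σ) (erase-renF (ext ρ) τ)
erase-renF ρ (fapp σ M) = erase-renF ρ σ
erase-renF ρ (σ ⇒ʳ τ)   = cong₂ arr (erase-renF ρ σ) (erase-renF ρ τ)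
erase-renF ρ (σ ∩ τ)    = cong₂ prod (erase-renF ρ σ) (erase-renF ρ τ)
erase-renF ρ (σ ∪ τ)    = cong₂ sum (erase-renF ρ σ) (erase-renF ρ τ)

erase-⟶ : ∀ {σ τ} → σ ⟶F τ → erase σ ≡ erase τ
erase-⟶ (fΠ₁ r)   = cong (λ A → pi A _) (erase-⟶ r)
erase-⟶ (fΠ₂ r)   = cong (pi _) (erase-⟶ r)
erase-⟶ (fapp₁ r) = erase-⟶ r
erase-⟶ (fapp₂ r) = refl
erase-⟶ (⇒₁ r)    = cong (λ A → arr A _) (erase-⟶ r)
erase-⟶ (⇒₂ r)    = cong (arr _) (erase-⟶ r)
erase-⟶ (∩₁ r)    = cong (λ A → prod A _) (erase-⟶ r)
erase-⟶ (∩₂ r)    = cong (prod _) (erase-⟶ r)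
erase-⟶ (∪₁ r)    = cong (λ A → sum A _) (erase-⟶ r)
erase-⟶ (∪₂ r)    = cong (sum _) (erase-⟶ r)

erase-=F : ∀ {σ τ} → σ =F τ → erase σ ≡ erase τ
erase-=F ε            = refl
erase-=F (fwd r ◅ rs) = trans (erase-⟶ r) (erase-=F rs)
erase-=F (bwd r ◅ rs) = trans (sym (erase-⟶ r)) (erase-=F rs)

Acc-pullback : ∀ {A B : Set} {R : A → A → Set} {S : B → B → Set} (f : A → B) →
               (∀ {x y} → R x y → S (f x) (f y)) → ∀ {x} → Acc S (f x) → Acc R x
Acc-pullback f h = Subrelation.accessible h ∘ On.accessible f

SNK-kΠ : ∀ {σ K} → SNF σ → SNK K → SNK (kΠ σ K)
SNK-kΠ (acc a) (acc b) = acc λ { (kΠ₁ r) → SNK-kΠ (a r) (acc b) ; (kΠ₂ r) → SNK-kΠ (acc a) (b r) }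

SNF-fΠ : ∀ {σ τ} → SNF σ → SNF τ → SNF (fΠ σ τ)
SNF-fΠ (acc a) (acc b) = acc λ { (fΠ₁ r) → SNF-fΠ (a r) (acc b) ; (fΠ₂ r) → SNF-fΠ (acc a) (b r) }

SNF-fapp : ∀ {σ M} → SNF σ → SNO M → SNF (fapp σ M)
SNF-fapp (acc a) (acc b) = acc λ { (fapp₁ r) → SNF-fapp (a r) (acc b) ; (fapp₂ r) → SNF-fapp (acc a) (b r) }

SNF-⇒ʳ : ∀ {σ τ} → SNF σ → SNF τ → SNF (σ ⇒ʳ τ)
SNF-⇒ʳ (acc a) (acc b) = acc λ { (⇒₁ r) → SNF-⇒ʳ (a r) (acc b) ; (⇒₂ r) → SNF-⇒ʳ (acc a) (b r) }

SNF-∩ : ∀ {σ τ} → SNF σ → SNF τ → SNF (σ ∩ τ)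
SNF-∩ (acc a) (acc b) = acc λ { (∩₁ r) → SNF-∩ (a r) (acc b) ; (∩₂ r) → SNF-∩ (acc a) (b r) }

SNF-∪ : ∀ {σ τ} → SNF σ → SNF τ → SNF (σ ∪ τ)
SNF-∪ (acc a) (acc b) = acc λ { (∪₁ r) → SNF-∪ (a r) (acc b) ; (∪₂ r) → SNF-∪ (acc a) (b r) }

SNF-∪⁻ˡ : ∀ {σ τ} → SNF (σ ∪ τ) → SNF σ
SNF-∪⁻ˡ = Acc-pullback (_∪ _) ∪₁

SNF-∪⁻ʳ : ∀ {σ τ} → SNF (σ ∪ τ) → SNF τ
SNF-∪⁻ʳ = Acc-pullback (_ ∪_) ∪₂

SNO-inl : ∀ {σ M} → SNF σ → SNO M → SNO (inl σ M)
SNO-inl (acc a) (acc b) = acc λ { (inl₁ r) → SNO-inl (a r) (acc b) ; (inl₂ r) → SNO-inl (acc a) (b r) }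

SNO-inr : ∀ {σ M} → SNF σ → SNO M → SNO (inr σ M)
SNO-inr (acc a) (acc b) = acc λ { (inr₁ r) → SNO-inr (a r) (acc b) ; (inr₂ r) → SNO-inr (acc a) (b r) }

SNK-exts : ∀ s K → SNK (subK (var 0 ∷ₛ s) K) → SNK (subK (exts s) K)
SNK-exts s K sn =
  Acc-pullback (_[ var 0 ]K) (subK-⟶ (sub0 (var 0))) (subst SNK (sym (exts-[]K (var 0) s K)) sn)

SNF-exts : ∀ s σ → SNF (subF (var 0 ∷ₛ s) σ) → SNF (subF (exts s) σ)
SNF-exts s σ sn =
  Acc-pullback (_[ var 0 ]F) (subF-⟶ (sub0 (var 0))) (subst SNF (sym (exts-[]F (var 0) s σ)) sn)

SNO-exts : ∀ s M → SNO (subO (var 0 ∷ₛ s) M) → SNO (subO (exts s) M)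
SNO-exts s M sn =
  Acc-pullback (_[ var 0 ]O) (subO-⟶ (sub0 (var 0))) (subst SNO (sym (exts-[]O (var 0) s M)) sn)

_⟶*_ : Obj → Obj → Set
_⟶*_ = Star _⟶O_

Neutral : Obj → Set
Neutral (oc c)     = ⊤
Neutral (var x)    = ⊤
Neutral (app M N)  = ⊤
Neutral (appr M N) = ⊤
Neutral (prl M)    = ⊤
Neutral (prr M)    = ⊤
Neutral _          = ⊥

Red : Ty → Obj → Set
Red base       M = SNO M
Red (pi A B)   M = ∀ N → Red A N → Red B (app M N)
Red (arr A B)  M = ∀ N → Red A N → Red B (appr M N)
Red (prod A B) M = Red A (prl M) × Red B (prr M)
Red (sum A B)  M = SNO M × (∀ σ Q → M ⟶* inl σ Q → Red A Q) × (∀ σ Q → M ⟶* inr σ Q → Red B Q)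

Red-cast : ∀ {A B M} → A ≡ B → Red A M → Red B M
Red-cast refl r = r

Red⇒SN      : ∀ A {M} → Red A M → SNO M
Red-⟶       : ∀ A {M M′} → M ⟶O M′ → Red A M → Red A M′
Red-neutral : ∀ A {M} → Neutral M → (∀ {M′} → M ⟶O M′ → Red A M′) → Red A M

Red-var : ∀ A x → Red A (var x)
Red-var A x = Red-neutral A tt (λ ())

Red⇒SN base       r = r
Red⇒SN (pi A B)   r = Acc-pullback (λ M → app M (var 0)) app₁ (Red⇒SN B (r (var 0) (Red-var A 0)))
Red⇒SN (arr A B)  r = Acc-pullback (λ M → appr M (var 0)) appr₁ (Red⇒SN B (r (var 0) (Red-var A 0)))
Red⇒SN (prod A B) r = Acc-pullback prl prl₁ (Red⇒SN A (proj₁ r))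
Red⇒SN (sum A B)  r = proj₁ r

Red-⟶ base       st (acc rs) = rs st
Red-⟶ (pi A B)   st r N rN = Red-⟶ B (app₁ st) (r N rN)
Red-⟶ (arr A B)  st r N rN = Red-⟶ B (appr₁ st) (r N rN)
Red-⟶ (prod A B) st (rl , rr) = Red-⟶ A (prl₁ st) rl , Red-⟶ B (prr₁ st) rr
Red-⟶ (sum A B)  st (acc rs , l , r) = rs st , (λ σ Q p → l σ Q (st ◅ p)) , (λ σ Q p → r σ Q (st ◅ p))

Red-neutral base ne h = acc h
Red-neutral (pi A B) {M} ne h N rN = applied (Red⇒SN A rN) rN
  where
  applied : ∀ {N} → SNO N → Red A N → Red B (app M N)
  applied {N} (acc rs) rN = Red-neutral B tt step
    where
    step : ∀ {M′} → app M N ⟶O M′ → Red B M′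
    step β-λ      = ⊥-elim ne
    step β-inl    = ⊥-elim ne
    step β-inr    = ⊥-elim ne
    step (app₁ s) = h s N rN
    step (app₂ s) = applied (rs s) (Red-⟶ A s rN)
Red-neutral (arr A B) {M} ne h N rN = applied (Red⇒SN A rN) rN
  where
  applied : ∀ {N} → SNO N → Red A N → Red B (appr M N)
  applied {N} (acc rs) rN = Red-neutral B tt step
    where
    step : ∀ {M′} → appr M N ⟶O M′ → Red B M′
    step β-λʳ      = ⊥-elim ne
    step (appr₁ s) = h s N rN
    step (appr₂ s) = applied (rs s) (Red-⟶ A s rN)
Red-neutral (prod A B) {M} ne h = Red-neutral A tt left , Red-neutral B tt right
  where
  left : ∀ {M′} → prl M ⟶O M′ → Red A M′
  left β-prl    = ⊥-elim ne
  left (prl₁ s) = proj₁ (h s)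
  right : ∀ {M′} → prr M ⟶O M′ → Red B M′
  right β-prr    = ⊥-elim ne
  right (prr₁ s) = proj₂ (h s)
Red-neutral (sum A B) {M} ne h = acc (proj₁ ∘ h) , left , right
  where
  left : ∀ σ Q → M ⟶* inl σ Q → Red A Q
  left σ Q ε       = ⊥-elim ne
  left σ Q (s ◅ p) = proj₁ (proj₂ (h s)) σ Q p
  right : ∀ σ Q → M ⟶* inr σ Q → Red B Q
  right σ Q ε       = ⊥-elim ne
  right σ Q (s ◅ p) = proj₂ (proj₂ (h s)) σ Q p

Red-oc : ∀ A c → Red A (oc c)
Red-oc A c = Red-neutral A tt (λ ())

Red-lam : ∀ {A B σ M} → SNF σ → SNO M → (∀ N → Red A N → Red B (M [ N ]O)) →
          Red (pi A B) (lam σ M)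
Red-lam {A} {B} snσ snM body N rN = redex snσ snM (Red⇒SN A rN) body rN
  where
  redex : ∀ {σ M N} → SNF σ → SNO M → SNO N → (∀ N → Red A N → Red B (M [ N ]O)) →
          Red A N → Red B (app (lam σ M) N)
  redex {σ} {M} {N} (acc a) (acc b) (acc c) body rN = Red-neutral B tt step
    where
    step : ∀ {M′} → app (lam σ M) N ⟶O M′ → Red B M′
    step β-λ             = body N rN
    step (app₁ (lam₁ r)) = redex (a r) (acc b) (acc c) body rN
    step (app₁ (lam₂ r)) =
      redex (acc a) (b r) (acc c) (λ N′ rN′ → Red-⟶ B (subO-⟶ (sub0 N′) r) (body N′ rN′)) rN
    step (app₂ r)        = redex (acc a) (acc b) (c r) body (Red-⟶ A r rN)

Red-lamr : ∀ {A B σ M} → SNF σ → SNO M → (∀ N → Red A N → Red B (M [ N ]O)) →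
           Red (arr A B) (lamr σ M)
Red-lamr {A} {B} snσ snM body N rN = redex snσ snM (Red⇒SN A rN) body rN
  where
  redex : ∀ {σ M N} → SNF σ → SNO M → SNO N → (∀ N → Red A N → Red B (M [ N ]O)) →
          Red A N → Red B (appr (lamr σ M) N)
  redex {σ} {M} {N} (acc a) (acc b) (acc c) body rN = Red-neutral B tt step
    where
    step : ∀ {M′} → appr (lamr σ M) N ⟶O M′ → Red B M′
    step β-λʳ               = body N rN
    step (appr₁ (lamr₁ r))  = redex (a r) (acc b) (acc c) body rN
    step (appr₁ (lamr₂ r))  =
      redex (acc a) (b r) (acc c) (λ N′ rN′ → Red-⟶ B (subO-⟶ (sub0 N′) r) (body N′ rN′)) rN
    step (appr₂ r)          = redex (acc a) (acc b) (c r) body (Red-⟶ A r rN)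

Red-pair : ∀ {A B M N} → Red A M → Red B N → Red (prod A B) (pair M N)
Red-pair {A} {B} rM rN = left (Red⇒SN A rM) rM rN , right (Red⇒SN B rN) rM rN
  where
  left : ∀ {M N} → SNO M → Red A M → Red B N → Red A (prl (pair M N))
  left {M} {N} (acc a) rM rN = Red-neutral A tt step
    where
    step : ∀ {M′} → prl (pair M N) ⟶O M′ → Red A M′
    step β-prl                    = rM
    step (prl₁ (pair₁₂ r r′ _)) = left (a r) (Red-⟶ A r rM) (Red-⟶ B r′ rN)
  right : ∀ {M N} → SNO N → Red A M → Red B N → Red B (prr (pair M N))
  right {M} {N} (acc a) rM rN = Red-neutral B tt step
    where
    step : ∀ {M′} → prr (pair M N) ⟶O M′ → Red B M′
    step β-prr                    = rN
    step (prr₁ (pair₁₂ r r′ _)) = right (a r′) (Red-⟶ A r rM) (Red-⟶ B r′ rN)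

Red-inl : ∀ {A B σ M} → SNF σ → Red A M → Red (sum A B) (inl σ M)
Red-inl {A} {B} snσ rM = SNO-inl snσ (Red⇒SN A rM) , left rM , right
  where
  left : ∀ {σ M} → Red A M → ∀ σ′ Q → inl σ M ⟶* inl σ′ Q → Red A Q
  left rM σ′ Q ε              = rM
  left rM σ′ Q (inl₁ s ◅ p) = left rM σ′ Q p
  left rM σ′ Q (inl₂ s ◅ p) = left (Red-⟶ A s rM) σ′ Q p
  right : ∀ {σ M} σ′ Q → inl σ M ⟶* inr σ′ Q → Red B Q
  right σ′ Q (inl₁ s ◅ p) = right σ′ Q p
  right σ′ Q (inl₂ s ◅ p) = right σ′ Q p

Red-inr : ∀ {A B σ M} → SNF σ → Red B M → Red (sum A B) (inr σ M)
Red-inr {A} {B} snσ rM = SNO-inr snσ (Red⇒SN B rM) , left , right rM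
  where
  right : ∀ {σ M} → Red B M → ∀ σ′ Q → inr σ M ⟶* inr σ′ Q → Red B Q
  right rM σ′ Q ε              = rM
  right rM σ′ Q (inr₁ s ◅ p) = right rM σ′ Q p
  right rM σ′ Q (inr₂ s ◅ p) = right (Red-⟶ B s rM) σ′ Q p
  left : ∀ {σ M} σ′ Q → inr σ M ⟶* inl σ′ Q → Red A Q
  left σ′ Q (inr₁ s ◅ p) = left σ′ Q p
  left σ′ Q (inr₂ s ◅ p) = left σ′ Q p

Red-copair : ∀ {A B C M N} → Red (pi A C) M → Red (pi B C) N → Red (pi (sum A B) C) (copair M N)
Red-copair {A} {B} {C} rM rN P rP@(snP , _) =
  redex (Red⇒SN (pi A C) rM) (Red⇒SN (pi B C) rN) snP rM rN rP
  where
  redex : ∀ {M N P} → SNO M → SNO N → SNO P →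
          Red (pi A C) M → Red (pi B C) N → Red (sum A B) P → Red C (app (copair M N) P)
  redex {M} {N} {P} (acc a) (acc b) (acc c) rM rN rP@(_ , toInl , toInr) = Red-neutral C tt step
    where
    step : ∀ {M′} → app (copair M N) P ⟶O M′ → Red C M′
    step (β-inl {σ = σ} {P = Q}) = rM Q (toInl σ Q ε)
    step (β-inr {σ = σ} {P = Q}) = rN Q (toInr σ Q ε)
    step (app₁ (copair₁₂ r r′ _)) =
      redex (a r) (b r′) (acc c) (Red-⟶ (pi A C) r rM) (Red-⟶ (pi B C) r′ rN) rP
    step (app₂ r) = redex (acc a) (acc b) (c r) rM rN (Red-⟶ (sum A B) r rP)

RedSub : Ctx → Sub → Set
RedSub Γ s = ∀ {x σ} → Γ ∋ x ∶ σ → Red (erase σ) (s x)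

RedSub-var : ∀ {Γ} → RedSub Γ var
RedSub-var {x = x} _ = Red-var _ x

RedSub-∷ : ∀ {Γ s σ N} → RedSub Γ s → Red (erase σ) N → RedSub (σ ∷ Γ) (N ∷ₛ s)
RedSub-∷ {σ = σ} h rN here      = Red-cast (sym (erase-renF suc σ)) rN
RedSub-∷ h rN (there {σ = σ} x) = Red-cast (sym (erase-renF suc σ)) (h x)

RedSub-tail : ∀ {Γ s σ} → RedSub (σ ∷ Γ) s → RedSub Γ (s ∘ suc)
RedSub-tail h {σ = σ} x = Red-cast (erase-renF suc σ) (h (there x))

-- The domain of a Π is only typed through the context, so each judgement also
-- yields strong normalisation of the (substituted) types in its context.
SNCtx : Ctx → Sub → Set
SNCtx []      s = ⊤
SNCtx (σ ∷ Γ) s = SNF (subF (s ∘ suc) σ) × SNCtx Γ (s ∘ suc)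

fundamentalCtx : ∀ {S Γ} → ⊢Ctx[ S ] Γ → ∀ s → RedSub Γ s → SNCtx Γ s
fundamentalK   : ∀ {S Γ K} → Γ ⊢[ S ]K K → ∀ s → RedSub Γ s → SNK (subK s K) × SNCtx Γ s
fundamentalF   : ∀ {S Γ σ K} → Γ ⊢[ S ]F σ ∶ K → ∀ s → RedSub Γ s → SNF (subF s σ) × SNCtx Γ s
fundamentalO   : ∀ {S Γ M σ} → Γ ⊢[ S ]O M ∶ σ → ∀ s → RedSub Γ s →
                 Red (erase σ) (subO s M) × SNCtx Γ s

fundamentalCtx (c-empty _) s h = tt
fundamentalCtx (c-ext c d) s h =
  proj₁ (fundamentalF d (s ∘ suc) (RedSub-tail h)) , fundamentalCtx c (s ∘ suc) (RedSub-tail h)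

fundamentalK (k-type c) s h = acc (λ ()) , fundamentalCtx c s h
fundamentalK (k-Π {K = K} d) s h =
  let snK , snσ , snΓ = fundamentalK d (var 0 ∷ₛ s) (RedSub-∷ h (Red-var _ 0))
  in  SNK-kΠ snσ (SNK-exts s K snK) , snΓ

fundamentalF (f-const c _) s h = acc (λ ()) , fundamentalCtx c s h
fundamentalF (f-Π {τ = τ} d) s h =
  let snτ , snσ , snΓ = fundamentalF d (var 0 ∷ₛ s) (RedSub-∷ h (Red-var _ 0))
  in  SNF-fΠ snσ (SNF-exts s τ snτ) , snΓ
fundamentalF (f-app d e) s h =
  let snσ , snΓ = fundamentalF d s h
  in  SNF-fapp snσ (Red⇒SN _ (proj₁ (fundamentalO e s h))) , snΓ
fundamentalF (f-⇒ d e) s h =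
  let snσ , snΓ = fundamentalF d s h in SNF-⇒ʳ snσ (proj₁ (fundamentalF e s h)) , snΓ
fundamentalF (f-∩ d e) s h =
  let snσ , snΓ = fundamentalF d s h in SNF-∩ snσ (proj₁ (fundamentalF e s h)) , snΓ
fundamentalF (f-∪ d e) s h =
  let snσ , snΓ = fundamentalF d s h in SNF-∪ snσ (proj₁ (fundamentalF e s h)) , snΓ
fundamentalF (f-conv d _ _) s h = fundamentalF d s h

fundamentalO (o-const c _) s h = Red-oc _ _ , fundamentalCtx c s h
fundamentalO (o-var c x)   s h = h x , fundamentalCtx c s h
fundamentalO (o-lam {τ = τ} {M = M} d) s h =
  let rM , snσ , snΓ = fundamentalO d (var 0 ∷ₛ s) (RedSub-∷ h (Red-var _ 0))
  in  Red-lam snσ (SNO-exts s M (Red⇒SN _ rM)) body , snΓ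
  where
  body : ∀ N → Red _ N → Red (erase τ) (subO (exts s) M [ N ]O)
  body N rN =
    subst (Red (erase τ)) (sym (exts-[]O N s M)) (proj₁ (fundamentalO d (N ∷ₛ s) (RedSub-∷ h rN)))
fundamentalO (o-app {τ = τ} {N = N} d e) s h =
  let rM , snΓ = fundamentalO d s h
  in  Red-cast (sym (erase-subF (sub0 N) τ)) (rM _ (proj₁ (fundamentalO e s h))) , snΓ
fundamentalO (o-lamr {τ = τ} {M = M} d _) s h =
  let rM , snσ , snΓ = fundamentalO d (var 0 ∷ₛ s) (RedSub-∷ h (Red-var _ 0))
  in  Red-lamr snσ (SNO-exts s M (Red⇒SN _ rM)) body , snΓ
  where
  body : ∀ N → Red _ N → Red (erase τ) (subO (exts s) M [ N ]O)
  body N rN =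
    subst (Red (erase τ)) (sym (exts-[]O N s M))
      (Red-cast (erase-renF suc τ) (proj₁ (fundamentalO d (N ∷ₛ s) (RedSub-∷ h rN))))
fundamentalO (o-appr d e) s h =
  let rM , snΓ = fundamentalO d s h in rM _ (proj₁ (fundamentalO e s h)) , snΓ
fundamentalO (o-pair d e _) s h =
  let rM , snΓ = fundamentalO d s h in Red-pair rM (proj₁ (fundamentalO e s h)) , snΓ
fundamentalO (o-prl d) s h = let (rl , _) , snΓ = fundamentalO d s h in rl , snΓ
fundamentalO (o-prr d) s h = let (_ , rr) , snΓ = fundamentalO d s h in rr , snΓ
fundamentalO (o-inl d f) s h =
  let rM , snΓ = fundamentalO d s h in Red-inl (SNF-∪⁻ʳ (proj₁ (fundamentalF f s h))) rM , snΓ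
fundamentalO (o-inr d f) s h =
  let rM , snΓ = fundamentalO d s h in Red-inr (SNF-∪⁻ˡ (proj₁ (fundamentalF f s h))) rM , snΓ
fundamentalO (o-copair {σ = σ} {τ = τ} {ρ = ρ} d e _ _) s h =
  let rM , snΓ = fundamentalO d s h
  in  Red-copair (Red-cast (cong (pi (erase σ)) (erase-subF (inlSub τ) ρ)) rM)
                 (Red-cast (cong (pi (erase τ)) (erase-subF (inrSub σ) ρ)) (proj₁ (fundamentalO e s h)))
      , snΓ
fundamentalO (o-conv d _ eq) s h =
  let rM , snΓ = fundamentalO d s h in Red-cast (erase-=F eq) rM , snΓ

⊢K⇒SN : ∀ {S Γ K} → Γ ⊢[ S ]K K → SNK K
⊢K⇒SN {K = K} d = subst SNK (subK-var K) (proj₁ (fundamentalK d var RedSub-var))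

⊢F⇒SN : ∀ {S Γ σ K} → Γ ⊢[ S ]F σ ∶ K → SNF σ
⊢F⇒SN {σ = σ} d = subst SNF (subF-var σ) (proj₁ (fundamentalF d var RedSub-var))

⊢O⇒SN : ∀ {S Γ M σ} → Γ ⊢[ S ]O M ∶ σ → SNO M
⊢O⇒SN {M = M} d = subst SNO (subO-var M) (Red⇒SN _ (proj₁ (fundamentalO d var RedSub-var)))

-- Intersection types for strongly normalising λ-terms

infixr 7 _↦_
infixl 8 _⊓_
infix  4 _≤ᵢ_ _≼_ _∣_⊢_∶_

data ITy : Set where
  o       : ITy
  _↦_ _⊓_ : ITy → ITy → ITy

data _≤ᵢ_ : ITy → ITy → Set where
  ≤ᵢ-refl  : ∀ {A} → A ≤ᵢ A
  ≤ᵢ-trans : ∀ {A B C} → A ≤ᵢ B → B ≤ᵢ C → A ≤ᵢ C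
  ⊓-≤ˡ     : ∀ {A B} → A ⊓ B ≤ᵢ A
  ⊓-≤ʳ     : ∀ {A B} → A ⊓ B ≤ᵢ B
  ⊓-glb    : ∀ {A B C} → A ≤ᵢ B → A ≤ᵢ C → A ≤ᵢ B ⊓ C

Env : Set
Env = ℕ → ITy

infixr 5 _∷ₑ_

_∷ₑ_ : ITy → Env → Env
(A ∷ₑ Γ) zero    = A
(A ∷ₑ Γ) (suc n) = Γ n

_∧_ : Env → Env → Env
(Γ ∧ Δ) x = Γ x ⊓ Δ x

_≼_ : Env → Env → Set
Γ ≼ Δ = ∀ x → Γ x ≤ᵢ Δ x

≼-refl : ∀ {Γ} → Γ ≼ Γ
≼-refl x = ≤ᵢ-refl

∧-≼ˡ : ∀ {Γ Δ} → (Γ ∧ Δ) ≼ Γ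
∧-≼ˡ x = ⊓-≤ˡ

∧-≼ʳ : ∀ {Γ Δ} → (Γ ∧ Δ) ≼ Δ
∧-≼ʳ x = ⊓-≤ʳ

≼-∷ : ∀ {Γ Δ} A → Γ ≼ Δ → (A ∷ₑ Γ) ≼ (A ∷ₑ Δ)
≼-∷ A p zero    = ≤ᵢ-refl
≼-∷ A p (suc n) = p n

data _∣_⊢_∶_ (Θ : Env) : Env → Λ → ITy → Set where
  ⊢v : ∀ {Γ x A} → Γ x ≤ᵢ A → Θ ∣ Γ ⊢ v x ∶ A
  ⊢c : ∀ {Γ c A} → Θ c ≤ᵢ A → Θ ∣ Γ ⊢ cst c ∶ A
  ⊢ƛ : ∀ {Γ M A B} → Θ ∣ A ∷ₑ Γ ⊢ M ∶ B → Θ ∣ Γ ⊢ ƛ M ∶ A ↦ B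
  ⊢· : ∀ {Γ M N A B} → Θ ∣ Γ ⊢ M ∶ A ↦ B → Θ ∣ Γ ⊢ N ∶ A → Θ ∣ Γ ⊢ M · N ∶ B
  ⊢⊓ : ∀ {Γ M A B} → Θ ∣ Γ ⊢ M ∶ A → Θ ∣ Γ ⊢ M ∶ B → Θ ∣ Γ ⊢ M ∶ A ⊓ B

⊢-narrow : ∀ {Θ Θ′ Γ Γ′ M A} → Θ ≼ Θ′ → Γ ≼ Γ′ → Θ′ ∣ Γ′ ⊢ M ∶ A → Θ ∣ Γ ⊢ M ∶ A
⊢-narrow q p (⊢v {x = x} r) = ⊢v (≤ᵢ-trans (p x) r)
⊢-narrow q p (⊢c {c = c} r) = ⊢c (≤ᵢ-trans (q c) r)
⊢-narrow q p (⊢ƛ {A = A} d) = ⊢ƛ (⊢-narrow q (≼-∷ A p) d)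
⊢-narrow q p (⊢· d e)       = ⊢· (⊢-narrow q p d) (⊢-narrow q p e)
⊢-narrow q p (⊢⊓ d e)       = ⊢⊓ (⊢-narrow q p d) (⊢-narrow q p e)

⊢v-inv : ∀ {Θ Γ x A} → Θ ∣ Γ ⊢ v x ∶ A → Γ x ≤ᵢ A
⊢v-inv (⊢v p)   = p
⊢v-inv (⊢⊓ d e) = ⊓-glb (⊢v-inv d) (⊢v-inv e)

⊢c-inv : ∀ {Θ Γ c A} → Θ ∣ Γ ⊢ cst c ∶ A → Θ c ≤ᵢ A
⊢c-inv (⊢c p)   = p
⊢c-inv (⊢⊓ d e) = ⊓-glb (⊢c-inv d) (⊢c-inv e)

RenAgrees : Env → Env → Ren → Set
RenAgrees Γ Γ′ ρ = ∀ x → Γ′ (ρ x) ≡ Γ x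

RenAgrees-ext : ∀ {Γ Γ′ ρ} A → RenAgrees Γ Γ′ ρ → RenAgrees (A ∷ₑ Γ) (A ∷ₑ Γ′) (ext ρ)
RenAgrees-ext A e zero    = refl
RenAgrees-ext A e (suc n) = e n

⊢-renΛ : ∀ {Θ Γ Γ′ ρ M A} → RenAgrees Γ Γ′ ρ → Θ ∣ Γ ⊢ M ∶ A → Θ ∣ Γ′ ⊢ renΛ ρ M ∶ A
⊢-renΛ e (⊢v {x = x} p) = ⊢v (subst (_≤ᵢ _) (sym (e x)) p)
⊢-renΛ e (⊢c p)         = ⊢c p
⊢-renΛ e (⊢ƛ {A = A} d) = ⊢ƛ (⊢-renΛ (RenAgrees-ext A e) d)
⊢-renΛ e (⊢· d d′)      = ⊢· (⊢-renΛ e d) (⊢-renΛ e d′)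
⊢-renΛ e (⊢⊓ d d′)      = ⊢⊓ (⊢-renΛ e d) (⊢-renΛ e d′)

⊢-renΛ⁻¹ : ∀ {Θ Γ Γ′ ρ A} M → RenAgrees Γ Γ′ ρ → Θ ∣ Γ′ ⊢ renΛ ρ M ∶ A → Θ ∣ Γ ⊢ M ∶ A
⊢-renΛ⁻¹ (v x)   e d              = ⊢v (subst (_≤ᵢ _) (e x) (⊢v-inv d))
⊢-renΛ⁻¹ (cst c) e d              = ⊢c (⊢c-inv d)
⊢-renΛ⁻¹ (ƛ M)   e (⊢ƛ {A = A} d) = ⊢ƛ (⊢-renΛ⁻¹ M (RenAgrees-ext A e) d)
⊢-renΛ⁻¹ (ƛ M)   e (⊢⊓ d d′)      = ⊢⊓ (⊢-renΛ⁻¹ (ƛ M) e d) (⊢-renΛ⁻¹ (ƛ M) e d′)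
⊢-renΛ⁻¹ (M · N) e (⊢· d d′)      = ⊢· (⊢-renΛ⁻¹ M e d) (⊢-renΛ⁻¹ N e d′)
⊢-renΛ⁻¹ (M · N) e (⊢⊓ d d′)      = ⊢⊓ (⊢-renΛ⁻¹ (M · N) e d) (⊢-renΛ⁻¹ (M · N) e d′)

TypableSub : Env → Env → (ℕ → Λ) → Set
TypableSub Θ Γ s = ∀ x → Σ ITy (λ A → Θ ∣ Γ ⊢ s x ∶ A)

TypableSub-ext : ∀ {Θ Γ s} A → TypableSub Θ Γ s → TypableSub Θ (A ∷ₑ Γ) (extsΛ s)
TypableSub-ext A h zero    = A , ⊢v ≤ᵢ-refl
TypableSub-ext A h (suc n) = let B , d = h n in B , ⊢-renΛ (λ _ → refl) d

update : Env → ℕ → ITy → Env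
update Γ x B y with y ≟ x
... | yes _ = B
... | no  _ = Γ y

update-≡ : ∀ Γ x B → update Γ x B x ≡ B
update-≡ Γ x B with x ≟ x
... | yes _  = refl
... | no x≢x = ⊥-elim (x≢x refl)

Unsubstitution : Env → Env → (ℕ → Λ) → Λ → ITy → Set
Unsubstitution Θ Γ s M B = Σ Env (λ Δ → (Θ ∣ Δ ⊢ M ∶ B) × (∀ x → Θ ∣ Γ ⊢ s x ∶ Δ x))

Unsubstitution-⊓ : ∀ {Θ Γ s M A B} →
                   Unsubstitution Θ Γ s M A → Unsubstitution Θ Γ s M B → Unsubstitution Θ Γ s M (A ⊓ B)
Unsubstitution-⊓ (Δ₁ , d₁ , h₁) (Δ₂ , d₂ , h₂) =
  Δ₁ ∧ Δ₂ , ⊢⊓ (⊢-narrow ≼-refl ∧-≼ˡ d₁) (⊢-narrow ≼-refl ∧-≼ʳ d₂) , λ x → ⊢⊓ (h₁ x) (h₂ x)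

-- Each occurrence of a variable is typed separately; ⊓ joins the resulting types.
⊢-subΛ⁻¹ : ∀ {Θ Γ s B} M → TypableSub Θ Γ s → Θ ∣ Γ ⊢ subΛ s M ∶ B → Unsubstitution Θ Γ s M B
⊢-subΛ⁻¹ {Θ} {Γ} {s} {B} (v x) h d = update (proj₁ ∘ h) x B , ⊢v x∶B , typed
  where
  x∶B : update (proj₁ ∘ h) x B x ≤ᵢ B
  x∶B = subst (_≤ᵢ B) (sym (update-≡ _ x B)) ≤ᵢ-refl
  typed : ∀ y → Θ ∣ Γ ⊢ s y ∶ update (proj₁ ∘ h) x B y
  typed y with y ≟ x
  ... | yes refl = d
  ... | no  _    = proj₂ (h y)
⊢-subΛ⁻¹ (cst c) h d = proj₁ ∘ h , ⊢c (⊢c-inv d) , proj₂ ∘ h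
⊢-subΛ⁻¹ {Θ} {Γ} {s} (ƛ M) h (⊢ƛ {A = A} d) =
  let Δ , dM , hΔ = ⊢-subΛ⁻¹ M (TypableSub-ext A h) d
  in  Δ ∘ suc , ⊢ƛ (⊢-narrow ≼-refl (bound hΔ) dM) , λ n → ⊢-renΛ⁻¹ (s n) (λ _ → refl) (hΔ (suc n))
  where
  bound : ∀ {Δ} → (∀ x → Θ ∣ A ∷ₑ Γ ⊢ extsΛ s x ∶ Δ x) → A ∷ₑ Δ ∘ suc ≼ Δ
  bound hΔ zero    = ⊢v-inv (hΔ zero)
  bound hΔ (suc n) = ≤ᵢ-refl
⊢-subΛ⁻¹ (ƛ M)   h (⊢⊓ d d′) = Unsubstitution-⊓ (⊢-subΛ⁻¹ (ƛ M) h d) (⊢-subΛ⁻¹ (ƛ M) h d′)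
⊢-subΛ⁻¹ (M · N) h (⊢· d d′) =
  let Δ₁ , d₁ , h₁ = ⊢-subΛ⁻¹ M h d
      Δ₂ , d₂ , h₂ = ⊢-subΛ⁻¹ N h d′
  in  Δ₁ ∧ Δ₂ , ⊢· (⊢-narrow ≼-refl ∧-≼ˡ d₁) (⊢-narrow ≼-refl ∧-≼ʳ d₂) , λ x → ⊢⊓ (h₁ x) (h₂ x)
⊢-subΛ⁻¹ (M · N) h (⊢⊓ d d′) = Unsubstitution-⊓ (⊢-subΛ⁻¹ (M · N) h d) (⊢-subΛ⁻¹ (M · N) h d′)

Typable : Env → Env → Λ → Set
Typable Θ Γ N = Σ ITy (λ C → Θ ∣ Γ ⊢ N ∶ C)

-- The argument must be typable on its own since it may be discarded by M.
⊢-β-expand : ∀ {Θ Γ B} M N → Θ ∣ Γ ⊢ subΛ (sub0Λ N) M ∶ B → Typable Θ Γ N → Θ ∣ Γ ⊢ ƛ M · N ∶ B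
⊢-β-expand {Θ} {Γ} M N d (C , dN) =
  let Δ , dM , hΔ = ⊢-subΛ⁻¹ M typableSub0 d
  in  ⊢· (⊢ƛ (⊢-narrow ≼-refl (bound hΔ) dM)) (hΔ zero)
  where
  typableSub0 : TypableSub Θ Γ (sub0Λ N)
  typableSub0 zero    = C , dN
  typableSub0 (suc n) = Γ n , ⊢v ≤ᵢ-refl
  bound : ∀ {Δ} → (∀ x → Θ ∣ Γ ⊢ sub0Λ N x ∶ Δ x) → Δ zero ∷ₑ Γ ≼ Δ
  bound hΔ zero    = ≤ᵢ-refl
  bound hΔ (suc n) = ⊢v-inv (hΔ (suc n))

infixl 25 _·*_

_·*_ : Λ → List Λ → Λ
H ·* []       = H
H ·* (P ∷ Ps) = (H ·* Ps) · P

data HeadForm : Λ → Set where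
  var-head   : ∀ x Ps → HeadForm (v x ·* Ps)
  cst-head   : ∀ c Ps → HeadForm (cst c ·* Ps)
  abstr      : ∀ B → HeadForm (ƛ B)
  redex-head : ∀ B N Ps → HeadForm ((ƛ B · N) ·* Ps)

headForm : ∀ M → HeadForm M
headForm (cst c) = cst-head c []
headForm (v x)   = var-head x []
headForm (ƛ M)   = abstr M
headForm (M · N) with headForm M
... | var-head x Ps      = var-head x (N ∷ Ps)
... | cst-head c Ps      = cst-head c (N ∷ Ps)
... | abstr B            = redex-head B N []
... | redex-head B N′ Ps = redex-head B N′ (N ∷ Ps)

→β-·* : ∀ {M M′} Ps → M →β M′ → M ·* Ps →β M′ ·* Ps
→β-·* []       st = st
→β-·* (P ∷ Ps) st = ξ·ₗ (→β-·* Ps st)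

infix 4 _⊳_ _⊵_ _≺_

data _⊳_ : Λ → Λ → Set where
  ƛ⊳  : ∀ {M} → ƛ M ⊳ M
  ·⊳ˡ : ∀ {M N} → M · N ⊳ M
  ·⊳ʳ : ∀ {M N} → M · N ⊳ N

data _⊵_ : Λ → Λ → Set where
  ⊵-refl : ∀ {M} → M ⊵ M
  ⊵-step : ∀ {M N P} → M ⊵ N → N ⊳ P → M ⊵ P

_≺_ : Λ → Λ → Set
N ≺ M = (M →β N) ⊎ (M ⊳ N)

⊵-→β : ∀ {M N N′} → M ⊵ N → N →β N′ → Σ Λ (λ M′ → (M →β M′) × (M′ ⊵ N′))
⊵-→β ⊵-refl st = _ , st , ⊵-refl
⊵-→β (⊵-step p ƛ⊳) st =
  let M′ , st′ , p′ = ⊵-→β p (ξƛ st) in M′ , st′ , ⊵-step p′ ƛ⊳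
⊵-→β (⊵-step p ·⊳ˡ) st =
  let M′ , st′ , p′ = ⊵-→β p (ξ·ₗ st) in M′ , st′ , ⊵-step p′ ·⊳ˡ
⊵-→β (⊵-step p ·⊳ʳ) st =
  let M′ , st′ , p′ = ⊵-→β p (ξ·ᵣ st) in M′ , st′ , ⊵-step p′ ·⊳ʳ

SNβ-⊵⇒Acc≺ : ∀ {M N} → SNβ M → M ⊵ N → Acc _≺_ N
SNβ-⊵⇒Acc≺ {M} (acc sn) p = acc (below p)
  where
  below : ∀ {N} → M ⊵ N → ∀ {N′} → N′ ≺ N → Acc _≺_ N′
  below p (inj₁ st) = let M′ , st′ , p′ = ⊵-→β p st in SNβ-⊵⇒Acc≺ (sn st′) p′
  below p (inj₂ ƛ⊳)  = acc (below (⊵-step p ƛ⊳))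
  below p (inj₂ ·⊳ˡ) = acc (below (⊵-step p ·⊳ˡ))
  below p (inj₂ ·⊳ʳ) = acc (below (⊵-step p ·⊳ʳ))

spineTy : List ITy → ITy → ITy
spineTy []       B = B
spineTy (A ∷ As) B = spineTy As (A ↦ B)

data ⊢Args (Θ Γ : Env) : List Λ → List ITy → Set where
  []  : ⊢Args Θ Γ [] []
  _∷_ : ∀ {P Ps A As} → Θ ∣ Γ ⊢ P ∶ A → ⊢Args Θ Γ Ps As → ⊢Args Θ Γ (P ∷ Ps) (A ∷ As)

⊢Args-narrow : ∀ {Θ Θ′ Γ Γ′ Ps As} → Θ ≼ Θ′ → Γ ≼ Γ′ → ⊢Args Θ′ Γ′ Ps As → ⊢Args Θ Γ Ps As
⊢Args-narrow q p []       = []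
⊢Args-narrow q p (d ∷ ds) = ⊢-narrow q p d ∷ ⊢Args-narrow q p ds

⊢-·* : ∀ {Θ Γ H Ps As B} → Θ ∣ Γ ⊢ H ∶ spineTy As B → ⊢Args Θ Γ Ps As → Θ ∣ Γ ⊢ H ·* Ps ∶ B
⊢-·* d []         = d
⊢-·* d (dP ∷ dPs) = ⊢· (⊢-·* d dPs) dP

⊢-·*-head : ∀ {Θ Γ U U′ B} → (∀ {A} → Θ ∣ Γ ⊢ U′ ∶ A → Θ ∣ Γ ⊢ U ∶ A) →
            ∀ Ps → Θ ∣ Γ ⊢ U′ ·* Ps ∶ B → Θ ∣ Γ ⊢ U ·* Ps ∶ B
⊢-·*-head f []       d         = f d
⊢-·*-head f (P ∷ Ps) (⊢· d e)  = ⊢· (⊢-·*-head f Ps d) e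
⊢-·*-head f (P ∷ Ps) (⊢⊓ d e)  = ⊢⊓ (⊢-·*-head f (P ∷ Ps) d) (⊢-·*-head f (P ∷ Ps) e)

Typable∃ : Λ → Set
Typable∃ M = Σ Env (λ Θ → Σ Env (λ Γ → Typable Θ Γ M))

TypableArgs : List Λ → Set
TypableArgs Ps = Σ Env (λ Θ → Σ Env (λ Γ → Σ (List ITy) (⊢Args Θ Γ Ps)))

Acc≺⇒Typable     : ∀ M → Acc _≺_ M → Typable∃ M
Acc≺⇒TypableArgs : ∀ H Ps → Acc _≺_ (H ·* Ps) → TypableArgs Ps
Acc≺⇒TypableArg  : ∀ B N Ps → Acc _≺_ ((ƛ B · N) ·* Ps) → Typable∃ N

Acc≺⇒TypableArgs H []       _        = (λ _ → o) , (λ _ → o) , [] , []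
Acc≺⇒TypableArgs H (P ∷ Ps) (acc rs) =
  let Θ₁ , Γ₁ , As , dPs = Acc≺⇒TypableArgs H Ps (rs (inj₂ ·⊳ˡ))
      Θ₂ , Γ₂ , A , dP   = Acc≺⇒Typable P (rs (inj₂ ·⊳ʳ))
  in  Θ₁ ∧ Θ₂ , Γ₁ ∧ Γ₂ , A ∷ As , ⊢-narrow ∧-≼ʳ ∧-≼ʳ dP ∷ ⊢Args-narrow ∧-≼ˡ ∧-≼ˡ dPs

Acc≺⇒TypableArg B N []       (acc rs) = Acc≺⇒Typable N (rs (inj₂ ·⊳ʳ))
Acc≺⇒TypableArg B N (P ∷ Ps) (acc rs) = Acc≺⇒TypableArg B N Ps (rs (inj₂ ·⊳ˡ))

Acc≺⇒Typable M a with headForm M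
Acc≺⇒Typable .(ƛ B) (acc rs) | abstr B =
  let Θ , Γ , A , d = Acc≺⇒Typable B (rs (inj₂ ƛ⊳))
  in  Θ , Γ ∘ suc , Γ zero ↦ A , ⊢ƛ (⊢-narrow ≼-refl split d)
  where
  split : ∀ {Γ} → Γ zero ∷ₑ Γ ∘ suc ≼ Γ
  split zero    = ≤ᵢ-refl
  split (suc n) = ≤ᵢ-refl
Acc≺⇒Typable .(v x ·* Ps) a | var-head x Ps =
  let Θ , Γ , As , dPs = Acc≺⇒TypableArgs (v x) Ps a
  in  Θ , (λ y → Γ y ⊓ spineTy As o) , o , ⊢-·* (⊢v ⊓-≤ʳ) (⊢Args-narrow ≼-refl (λ _ → ⊓-≤ˡ) dPs)
Acc≺⇒Typable .(cst c ·* Ps) a | cst-head c Ps =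
  let Θ , Γ , As , dPs = Acc≺⇒TypableArgs (cst c) Ps a
  in  (λ y → Θ y ⊓ spineTy As o) , Γ , o , ⊢-·* (⊢c ⊓-≤ʳ) (⊢Args-narrow (λ _ → ⊓-≤ˡ) ≼-refl dPs)
Acc≺⇒Typable .((ƛ B · N) ·* Ps) a@(acc rs) | redex-head B N Ps =
  let Θ₁ , Γ₁ , A , d  = Acc≺⇒Typable (subΛ (sub0Λ N) B ·* Ps) (rs (inj₁ (→β-·* Ps β)))
      Θ₂ , Γ₂ , C , dN = Acc≺⇒TypableArg B N Ps a
      expand : ∀ {A} → Θ₁ ∧ Θ₂ ∣ Γ₁ ∧ Γ₂ ⊢ subΛ (sub0Λ N) B ∶ A → Θ₁ ∧ Θ₂ ∣ Γ₁ ∧ Γ₂ ⊢ ƛ B · N ∶ A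
      expand dB = ⊢-β-expand B N dB (C , ⊢-narrow ∧-≼ʳ ∧-≼ʳ dN)
  in  Θ₁ ∧ Θ₂ , Γ₁ ∧ Γ₂ , A , ⊢-·*-head expand Ps (⊢-narrow ∧-≼ˡ ∧-≼ˡ d)

SNβ⇒Typable : ∀ M → SNβ M → Typable∃ M
SNβ⇒Typable M sn = Acc≺⇒Typable M (SNβ-⊵⇒Acc≺ sn ⊵-refl)

-- Annotating intersection-typed λ-terms

data VarsBelow (n : ℕ) : Λ → Set where
  v<  : ∀ {x} → x < n → VarsBelow n (v x)
  cst : ∀ {c} → VarsBelow n (cst c)
  ƛ   : ∀ {M} → VarsBelow (suc n) M → VarsBelow n (ƛ M)
  _·_ : ∀ {M N} → VarsBelow n M → VarsBelow n N → VarsBelow n (M · N)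

data ConstsBelow (m : ℕ) : Λ → Set where
  v    : ∀ {x} → ConstsBelow m (v x)
  cst< : ∀ {c} → c < m → ConstsBelow m (cst c)
  ƛ    : ∀ {M} → ConstsBelow m M → ConstsBelow m (ƛ M)
  _·_  : ∀ {M N} → ConstsBelow m M → ConstsBelow m N → ConstsBelow m (M · N)

VarsBelow-mono : ∀ {n n′ M} → n ≤ n′ → VarsBelow n M → VarsBelow n′ M
VarsBelow-mono le (v< p)  = v< (≤-trans p le)
VarsBelow-mono le cst     = cst
VarsBelow-mono le (ƛ b)   = ƛ (VarsBelow-mono (s≤s le) b)
VarsBelow-mono le (b · c) = VarsBelow-mono le b · VarsBelow-mono le c

ConstsBelow-mono : ∀ {m m′ M} → m ≤ m′ → ConstsBelow m M → ConstsBelow m′ M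
ConstsBelow-mono le v        = v
ConstsBelow-mono le (cst< p) = cst< (≤-trans p le)
ConstsBelow-mono le (ƛ b)    = ƛ (ConstsBelow-mono le b)
ConstsBelow-mono le (b · c)  = ConstsBelow-mono le b · ConstsBelow-mono le c

varsBelow : ∀ M → Σ ℕ (λ n → VarsBelow n M)
varsBelow (cst c) = 0 , cst
varsBelow (v x)   = suc x , v< ≤-refl
varsBelow (ƛ M)   = let n , b = varsBelow M in n , ƛ (VarsBelow-mono (n≤1+n n) b)
varsBelow (M · N) =
  let n , b = varsBelow M
      k , c = varsBelow N
  in  n ⊔ k , VarsBelow-mono (m≤m⊔n n k) b · VarsBelow-mono (m≤n⊔m n k) c

constsBelow : ∀ M → Σ ℕ (λ m → ConstsBelow m M)
constsBelow (cst c) = suc c , cst< ≤-refl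
constsBelow (v x)   = 0 , v
constsBelow (ƛ M)   = let m , b = constsBelow M in m , ƛ b
constsBelow (M · N) =
  let m , b = constsBelow M
      k , c = constsBelow N
  in  m ⊔ k , ConstsBelow-mono (m≤m⊔n m k) b · ConstsBelow-mono (m≤n⊔m m k) c

⟦_⟧ : ITy → Fam
⟦ o ⟧     = fc 0
⟦ A ↦ B ⟧ = fΠ ⟦ A ⟧ ⟦ B ⟧
⟦ A ⊓ B ⟧ = ⟦ A ⟧ ∩ ⟦ B ⟧

⟦⟧-renF : ∀ ρ A → renF ρ ⟦ A ⟧ ≡ ⟦ A ⟧
⟦⟧-renF ρ o       = refl
⟦⟧-renF ρ (A ↦ B) = cong₂ fΠ (⟦⟧-renF ρ A) (⟦⟧-renF (ext ρ) B)
⟦⟧-renF ρ (A ⊓ B) = cong₂ _∩_ (⟦⟧-renF ρ A) (⟦⟧-renF ρ B)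

⟦⟧-subF : ∀ s A → subF s ⟦ A ⟧ ≡ ⟦ A ⟧
⟦⟧-subF s o       = refl
⟦⟧-subF s (A ↦ B) = cong₂ fΠ (⟦⟧-subF s A) (⟦⟧-subF (exts s) B)
⟦⟧-subF s (A ⊓ B) = cong₂ _∩_ (⟦⟧-subF s A) (⟦⟧-subF s B)

⟦⟧-coh : ∀ A → CohF ⟦ A ⟧
⟦⟧-coh o       = tt
⟦⟧-coh (A ↦ B) = ⟦⟧-coh A , ⟦⟧-coh B
⟦⟧-coh (A ⊓ B) = ⟦⟧-coh A , ⟦⟧-coh B

⊢⟦⟧ : ∀ {S Γ} A → fdecl 0 type ∈ S → ⊢Ctx[ S ] Γ → Γ ⊢[ S ]F ⟦ A ⟧ ∶ type
⊢⟦⟧ o       i c = f-const c i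
⊢⟦⟧ (A ↦ B) i c = f-Π (⊢⟦⟧ B i (c-ext c (⊢⟦⟧ A i c)))
⊢⟦⟧ (A ⊓ B) i c = f-∩ (⊢⟦⟧ A i c) (⊢⟦⟧ B i c)

constSig : Env → ℕ → Sig
constSig Θ zero    = fdecl 0 type ∷ []
constSig Θ (suc m) = odecl m ⟦ Θ m ⟧ ∷ constSig Θ m

base∈constSig : ∀ Θ m → fdecl 0 type ∈ constSig Θ m
base∈constSig Θ zero    = here refl
base∈constSig Θ (suc m) = there (base∈constSig Θ m)

const∈constSig : ∀ Θ m c → c < m → odecl c ⟦ Θ c ⟧ ∈ constSig Θ m
const∈constSig Θ (suc m) c (s≤s c≤m) with c ≟ m
... | yes refl = here refl
... | no  c≢m  = there (const∈constSig Θ m c (≤∧≢⇒< c≤m c≢m))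

const∉constSig : ∀ Θ m k → m ≤ k → oname k ∉ dom (constSig Θ m)
const∉constSig Θ zero    k le (here ())
const∉constSig Θ zero    k le (there ())
const∉constSig Θ (suc m) k le (here refl) = <-irrefl refl le
const∉constSig Θ (suc m) k le (there p)   = const∉constSig Θ m k (≤-trans (n≤1+n m) le) p

⊢constSig : ∀ Θ m → ⊢Sig constSig Θ m
⊢constSig Θ zero    = s-fam s-empty (k-type (c-empty s-empty)) (λ ())
⊢constSig Θ (suc m) =
  s-obj (⊢constSig Θ m) (⊢⟦⟧ (Θ m) (base∈constSig Θ m) (c-empty (⊢constSig Θ m))) (const∉constSig Θ m m ≤-refl)

constSig-coh : ∀ Θ m → CohSig (constSig Θ m)
constSig-coh Θ zero    = tt ∷ []
constSig-coh Θ (suc m) = ⟦⟧-coh (Θ m) ∷ constSig-coh Θ m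

varCtx : Env → ℕ → Ctx
varCtx Γ zero    = []
varCtx Γ (suc n) = ⟦ Γ 0 ⟧ ∷ varCtx (Γ ∘ suc) n

⊢varCtx : ∀ {S} Γ n → fdecl 0 type ∈ S → ⊢Sig S → ⊢Ctx[ S ] varCtx Γ n
⊢varCtx Γ zero    i s = c-empty s
⊢varCtx Γ (suc n) i s = c-ext (⊢varCtx (Γ ∘ suc) n i s) (⊢⟦⟧ (Γ 0) i (⊢varCtx (Γ ∘ suc) n i s))

varCtx-coh : ∀ Γ n → CohCtx (varCtx Γ n)
varCtx-coh Γ zero    = []
varCtx-coh Γ (suc n) = ⟦⟧-coh (Γ 0) ∷ varCtx-coh (Γ ∘ suc) n

Lookup : Ctx → Env → ℕ → Set
Lookup L Γ n = ∀ x → x < n → L ∋ x ∶ ⟦ Γ x ⟧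

Lookup-∷ : ∀ {L Γ n} A → Lookup L Γ n → Lookup (⟦ A ⟧ ∷ L) (A ∷ₑ Γ) (suc n)
Lookup-∷ {L} A lk zero    _         = subst ((⟦ A ⟧ ∷ L) ∋ zero ∶_) (⟦⟧-renF suc A) here
Lookup-∷ {L} {Γ} A lk (suc x) (s≤s le) =
  subst ((⟦ A ⟧ ∷ L) ∋ suc x ∶_) (⟦⟧-renF suc (Γ x)) (there (lk x le))

varCtx-lookup : ∀ Γ n → Lookup (varCtx Γ n) Γ n
varCtx-lookup Γ (suc n) zero    _         = subst (varCtx Γ (suc n) ∋ zero ∶_) (⟦⟧-renF suc (Γ 0)) here
varCtx-lookup Γ (suc n) (suc x) (s≤s x<n) =
  subst (varCtx Γ (suc n) ∋ suc x ∶_) (⟦⟧-renF suc (Γ (suc x))) (there (varCtx-lookup (Γ ∘ suc) n x x<n))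

coerce : ∀ {A B} → A ≤ᵢ B → Obj → Obj
coerce ≤ᵢ-refl        t = t
coerce (≤ᵢ-trans p q) t = coerce q (coerce p t)
coerce ⊓-≤ˡ           t = prl t
coerce ⊓-≤ʳ           t = prr t
coerce (⊓-glb p q)    t = pair (coerce p t) (coerce q t)

∣coerce∣ : ∀ {A B} (p : A ≤ᵢ B) t → ∣ coerce p t ∣ ≡ ∣ t ∣
∣coerce∣ ≤ᵢ-refl        t = refl
∣coerce∣ (≤ᵢ-trans p q) t = trans (∣coerce∣ q (coerce p t)) (∣coerce∣ p t)
∣coerce∣ ⊓-≤ˡ           t = refl
∣coerce∣ ⊓-≤ʳ           t = refl
∣coerce∣ (⊓-glb p q)    t = ∣coerce∣ p t

∣coerce∣≡∣coerce∣ : ∀ {A B C} (p : A ≤ᵢ B) (q : A ≤ᵢ C) t → ∣ coerce p t ∣ ≡ ∣ coerce q t ∣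
∣coerce∣≡∣coerce∣ p q t = trans (∣coerce∣ p t) (sym (∣coerce∣ q t))

coerce-coh : ∀ {A B} (p : A ≤ᵢ B) t → CohO t → CohO (coerce p t)
coerce-coh ≤ᵢ-refl        t c = c
coerce-coh (≤ᵢ-trans p q) t c = coerce-coh q (coerce p t) (coerce-coh p t c)
coerce-coh ⊓-≤ˡ           t c = c
coerce-coh ⊓-≤ʳ           t c = c
coerce-coh (⊓-glb p q)    t c = coerce-coh p t c , coerce-coh q t c , ∣coerce∣≡∣coerce∣ p q t

≡⇒=η : ∀ {M N} → M ≡ N → M =η N
≡⇒=η refl = ε

⊢coerce : ∀ {S L A B} (p : A ≤ᵢ B) t → L ⊢[ S ]O t ∶ ⟦ A ⟧ → L ⊢[ S ]O coerce p t ∶ ⟦ B ⟧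
⊢coerce ≤ᵢ-refl        t d = d
⊢coerce (≤ᵢ-trans p q) t d = ⊢coerce q (coerce p t) (⊢coerce p t d)
⊢coerce ⊓-≤ˡ           t d = o-prl d
⊢coerce ⊓-≤ʳ           t d = o-prr d
⊢coerce (⊓-glb p q)    t d = o-pair (⊢coerce p t d) (⊢coerce q t d) (≡⇒=η (∣coerce∣≡∣coerce∣ p q t))

Annotation : Sig → Ctx → Λ → ITy → Set
Annotation S L M A = Σ Obj (λ t → CohO t × (L ⊢[ S ]O t ∶ ⟦ A ⟧) × ∣ t ∣ ≡ M)

annotate-coerce : ∀ {S L A B} (p : A ≤ᵢ B) t → CohO t → L ⊢[ S ]O t ∶ ⟦ A ⟧ → Annotation S L ∣ t ∣ B
annotate-coerce p t c d = coerce p t , coerce-coh p t c , ⊢coerce p t d , ∣coerce∣ p t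

annotate : ∀ {Θ Γ M A n m L} → Θ ∣ Γ ⊢ M ∶ A → VarsBelow n M → ConstsBelow m M →
           Lookup L Γ n → ⊢Ctx[ constSig Θ m ] L → Annotation (constSig Θ m) L M A
annotate (⊢v {x = x} p) (v< x<n) _ lk c = annotate-coerce p (var x) tt (o-var c (lk x x<n))
annotate {Θ} {m = m} (⊢c {c = k} p) _ (cst< k<m) lk c =
  annotate-coerce p (oc k) tt (o-const c (const∈constSig Θ m k k<m))
annotate {Θ} {m = m} (⊢ƛ {A = A} d) (ƛ b) (ƛ b′) lk c =
  let t , ch , dt , e = annotate d b b′ (Lookup-∷ A lk) (c-ext c (⊢⟦⟧ A (base∈constSig Θ m) c))
  in  lam ⟦ A ⟧ t , (⟦⟧-coh A , ch) , o-lam dt , cong ƛ e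
annotate (⊢· {B = B} d d′) (b₁ · b₂) (b₁′ · b₂′) lk c =
  let t , ch , dt , e = annotate d b₁ b₁′ lk c
      u , ch′ , du , e′ = annotate d′ b₂ b₂′ lk c
  in  app t u , (ch , ch′) , subst (_ ⊢[ _ ]O app t u ∶_) (⟦⟧-subF (sub0 u) B) (o-app dt du) , cong₂ _·_ e e′
annotate (⊢⊓ d d′) b b′ lk c =
  let t , ch , dt , e = annotate d b b′ lk c
      u , ch′ , du , e′ = annotate d′ b b′ lk c
      t≡u = trans e (sym e′)
  in  pair t u , (ch , ch′ , t≡u) , o-pair dt du (≡⇒=η t≡u) , e

SNβ⇒essence : ∀ (M : Λ) → SNβ M →
              Σ[ S ∈ Sig ] Σ[ Γ ∈ Ctx ] Σ[ Δ ∈ Obj ] Σ[ σ ∈ Fam ]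
                (CohSig S × CohCtx Γ × CohO Δ × CohF σ × (Γ ⊢[ S ]O Δ ∶ σ) × ∣ Δ ∣ ≡ M)
SNβ⇒essence M sn =
  let Θ , Γ , A , d = SNβ⇒Typable M sn
      n , vars = varsBelow M
      m , consts = constsBelow M
      L⊢ = ⊢varCtx Γ n (base∈constSig Θ m) (⊢constSig Θ m)
      t , ch , dt , e = annotate d vars consts (varCtx-lookup Γ n) L⊢
  in  constSig Θ m , varCtx Γ n , t , ⟦ A ⟧ , constSig-coh Θ m , varCtx-coh Γ n , ch , ⟦⟧-coh A , dt , e

theorem4 :
    ((∀ (S : Sig) (Γ : Ctx) (K : Kind) →
        CohSig S → CohCtx Γ → CohK K →
        Γ ⊢[ S ]K K → SNK K)
     × (∀ (S : Sig) (Γ : Ctx) (σ : Fam) (K : Kind) →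
        CohSig S → CohCtx Γ → CohF σ → CohK K →
        Γ ⊢[ S ]F σ ∶ K → SNF σ)
     × (∀ (S : Sig) (Γ : Ctx) (M : Obj) (σ : Fam) →
        CohSig S → CohCtx Γ → CohO M → CohF σ →
        Γ ⊢[ S ]O M ∶ σ → SNO M))
    × (∀ (M : Λ) → SNβ M →
        Σ[ S ∈ Sig ] Σ[ Γ ∈ Ctx ] Σ[ Δ ∈ Obj ] Σ[ σ ∈ Fam ]
          (CohSig S × CohCtx Γ × CohO Δ × CohF σ ×
           (Γ ⊢[ S ]O Δ ∶ σ) × ∣ Δ ∣ ≡ M))
-- The reducibility argument never inspects essences.
theorem4 =
  ( (λ _ _ _ _ _ _ → ⊢K⇒SN)
  , (λ _ _ _ _ _ _ _ _ → ⊢F⇒SN)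
  , (λ _ _ _ _ _ _ _ _ → ⊢O⇒SN) )
  , SNβ⇒essence
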